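{- If $G,H\in I_{ -2}$ have the same parity, then $\psi(G)\le\psi(H)$ if and only if $G\lesssim H$. Consequently $\psi$ induces a well-defined homomorphism from $I_{ -2}/\approx$ to the group $\mathcal{G}$ of short partizan games which is weakly order-preserving ($G\lesssim H\Rightarrow\psi(G)\le\psi(H)$), and which is strictly order-preserving ($G\lesssim H\iff\psi(G)\le\psi(H)$) when restricted to even-tempered games. For $G\in I_{ -2}$, $\psi(G)=0$ if and only if $G\approx 0$ or $G\approx\langle -1\mid 1\rangle$; the kernel of this homomorphism has two elements.
   Context: Well-tempered $\mathbb{Z}$-valued games: an even-tempered game is an integer (a "number", with no options) or $\langle L\mid R\rangle$ with $L,R$ finite nonempty sets of odd-tempered games; an odd-tempered game is $\langle L\mid R\rangle$ with $L,R$ finite nonempty sets of even-tempered games. Outcomes: $L(n)=R(n)=n$ for numbers; otherwise $L(G)=\max_{G^L}R(G^L)$, $R(G)=\min_{G^R}L(G^R)$. Sum: integer sum if both numbers, otherwise $G+H=\langle G^L+H, G+H^L\mid G^R+H, G+H^R\rangle$. $G\lesssim H$ iff $L(G+X)\le L(H+X)$ and $R(G+X)\le R(H+X)$ for every $\mathbb{Z}$-valued $X$; $\approx$ is the associated equivalence. For an integer $n$, $I_n$ is defined recursively: $G\in I_n$ iff every option of $G$ is in $I_n$ and $L(G)\ge R(G)$ if $G$ is even-tempered, $L(G)-R(G)\ge n$ if $G$ is odd-tempered; $I_{ -2}$ is closed under $+$ and negation. $\mathcal{G}$ is the group of short (finite) partizan games in Conway's sense, modulo equality, with its usual partial order. The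 representation $\psi:I_{ -2}\to\mathcal{G}$ is defined by $\psi(n)=n$ (the integer as a surreal number) for integers $n$, and $\psi(G)=\{\psi(G^L)\mid\psi(G^R)\}$ if $G=\langle G^L\mid G^R\rangle$ is not a number. -}

module Defs where

open import Data.Nat using (ℕ; zero; suc; _+_)
open import Data.Fin using (Fin; zero; suc; splitAt)
open import Data.Sum using (_⊎_; inj₁; inj₂; [_,_])
open import Data.Product using (_×_; Σ)
open import Data.Empty using (⊥; ⊥-elim)
open import Data.Integer as ℤ using (ℤ; +_; -[1+_])

data PG : Set where
  mk : (m n : ℕ) → (Fin m → PG) → (Fin n → PG) → PG

-- Conway's order: x ≤ y and the strict "less or fuzzy" relation x ⧏ y
-- (x ⧏ y means ¬ (y ≤ x), stated positively).
mutual
  infix 4 _≤ᶜ_ _⧏ᶜ_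
  _≤ᶜ_ : PG → PG → Set
  mk a b xl xr ≤ᶜ mk c d yl yr =
    ((i : Fin a) → xl i ⧏ᶜ mk c d yl yr) × ((j : Fin d) → mk a b xl xr ⧏ᶜ yr j)

  _⧏ᶜ_ : PG → PG → Set
  mk a b xl xr ⧏ᶜ mk c d yl yr =
    Σ (Fin c) (λ i → mk a b xl xr ≤ᶜ yl i) ⊎ Σ (Fin b) (λ j → xr j ≤ᶜ mk c d yl yr)

infix 4 _≡ᶜ_
_≡ᶜ_ : PG → PG → Set
x ≡ᶜ y = (x ≤ᶜ y) × (y ≤ᶜ x)

infixl 6 _+ᶜ_
_+ᶜ_ : PG → PG → PG
mk a b xl xr +ᶜ mk c d yl yr =
  mk (a + c) (b + d)
     (λ i → [ (λ k → xl k +ᶜ mk c d yl yr) , (λ k → mk a b xl xr +ᶜ yl k) ] (splitAt a i))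
     (λ i → [ (λ k → xr k +ᶜ mk c d yl yr) , (λ k → mk a b xl xr +ᶜ yr k) ] (splitAt b i))

0ᶜ : PG
0ᶜ = mk 0 0 (λ ()) (λ ())

natPG : ℕ → PG
natPG zero = 0ᶜ
natPG (suc n) = mk 1 0 (λ _ → natPG n) (λ ())

negNatPG : ℕ → PG
negNatPG zero = 0ᶜ
negNatPG (suc n) = mk 0 1 (λ ()) (λ _ → negNatPG n)

intPG : ℤ → PG
intPG (+ n) = natPG n
intPG -[1+ n ] = negNatPG (suc n)

-- Z-valued scoring games with nonempty finite option sets
-- (num a is an integer, i.e. a game with no options)

data Game : Set where
  num  : ℤ → Game
  node : (m n : ℕ) → (Fin (suc m) → Game) → (Fin (suc n) → Game) → Game

data Parity : Set where
  even odd : Parity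

flip : Parity → Parity
flip even = odd
flip odd = even

data WellTempered : Parity → Game → Set where
  wnum  : ∀ a → WellTempered even (num a)
  wnode : ∀ {p m n l r} →
          ((i : Fin (suc m)) → WellTempered (flip p) (l i)) →
          ((j : Fin (suc n)) → WellTempered (flip p) (r j)) →
          WellTempered p (node m n l r)

maxF : ∀ m → (Fin (suc m) → ℤ) → ℤ
maxF zero f = f zero
maxF (suc m) f = f zero ℤ.⊔ maxF m (λ i → f (suc i))

minF : ∀ m → (Fin (suc m) → ℤ) → ℤ
minF zero f = f zero
minF (suc m) f = f zero ℤ.⊓ minF m (λ i → f (suc i))

mutual
  Lo : Game → ℤ
  Lo (num a) = a
  Lo (node m n l r) = maxF m (λ i → Ro (l i))

  Ro : Game → ℤ
  Ro (num a) = a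
  Ro (node m n l r) = minF n (λ j → Lo (r j))

infixl 6 _⊞_
_⊞_ : Game → Game → Game
num a ⊞ num b = num (a ℤ.+ b)
num a ⊞ node m n l r = node m n (λ i → num a ⊞ l i) (λ j → num a ⊞ r j)
node m n l r ⊞ num b = node m n (λ i → l i ⊞ num b) (λ j → r j ⊞ num b)
node m n l r ⊞ node m' n' l' r' =
  node (m + suc m') (n + suc n')
    (λ i → [ (λ k → l k ⊞ node m' n' l' r') , (λ k → node m n l r ⊞ l' k) ] (splitAt (suc m) i))
    (λ j → [ (λ k → r k ⊞ node m' n' l' r') , (λ k → node m n l r ⊞ r' k) ] (splitAt (suc n) j))

infix 4 _≲_ _≈_
_≲_ : Game → Game → Set
G ≲ H = (q : Parity) (X : Game) → WellTempered q X →
        (Lo (G ⊞ X) ℤ.≤ Lo (H ⊞ X)) × (Ro (G ⊞ X) ℤ.≤ Ro (H ⊞ X))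

_≈_ : Game → Game → Set
G ≈ H = (G ≲ H) × (H ≲ G)

data I (k : ℤ) : Parity → Game → Set where
  inum  : ∀ a → I k even (num a)
  ieven : ∀ {m n l r} →
          ((i : Fin (suc m)) → I k odd (l i)) →
          ((j : Fin (suc n)) → I k odd (r j)) →
          Ro (node m n l r) ℤ.≤ Lo (node m n l r) →
          I k even (node m n l r)
  iodd  : ∀ {m n l r} →
          ((i : Fin (suc m)) → I k even (l i)) →
          ((j : Fin (suc n)) → I k even (r j)) →
          k ℤ.≤ Lo (node m n l r) ℤ.- Ro (node m n l r) →
          I k odd (node m n l r)

I₋₂ : Parity → Game → Set
I₋₂ = I (ℤ.- (+ 2))

ψ : Game → PG
ψ (num a) = intPG a
ψ (node m n l r) = mk (suc m) (suc n) (λ i → ψ (l i)) (λ j → ψ (r j))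

⟨-1∣1⟩ : Game
⟨-1∣1⟩ = node 0 0 (λ _ → num (ℤ.- (+ 1))) (λ _ → num (+ 1))

-- The proof rests on a dictionary comparing ψ G with integers k: for
-- G ∈ I₋₂ even-tempered, k ≤ ψ G iff k ≤ R(G) and ψ G ≤ k iff L(G) ≤ k;
-- for G odd-tempered the right-hand inequalities are strict.  With it, an
-- induction on G, H and a test game X shows that ψ G ≤ ψ H gives
-- L(G+X) ≤ L(H+X) and R(G+X) ≤ R(H+X).  Conversely, if G ≲ H but ψ H ⧏ ψ G,
-- a mirror strategy on G - H, combined with the parity flip τ (each leaf h
-- becomes ⟨h-1 | h+1⟩, same ψ, outcomes moved by one), yields 1 ≤ 0.
-- Games of different parities are never comparable: a probe
-- ⟨⟨-N | -N⟩ | ⟨N | N⟩⟩ separates them.  Additivity is an induction whose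
-- only delicate case, an integer summand, uses that ψ (a + H) is strictly
-- increasing in a.

module Submission where

open import Defs
open import Data.Nat as ℕ using (zero; suc; z≤n; s≤s)
import Data.Nat.Properties as ℕP
open import Data.Fin using (Fin; zero; suc; splitAt; _↑ˡ_; _↑ʳ_)
open import Data.Fin.Properties using (splitAt-↑ˡ; splitAt-↑ʳ)
open import Data.Sum using (_⊎_; inj₁; inj₂; [_,_]; [_,_]′; swap)
open import Data.Product using (_×_; _,_; Σ; proj₁; proj₂)
open import Data.Empty using (⊥; ⊥-elim)
open import Data.Integer as ℤ using (ℤ; _≤_; _<_; +_; -[1+_]; 0ℤ; 1ℤ; -1ℤ; _+_; _-_; -_; _⊔_; _⊓_; ∣_∣)
import Data.Integer.Properties as ℤP
open import Data.Integer.Tactic.RingSolver using (solve-∀)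
open import Relation.Nullary using (¬_; yes; no)
open import Relation.Binary.PropositionalEquality
  using (_≡_; refl; sym; trans; cong; cong₂; subst; subst₂)

infixr 2 _⟫_
_⟫_ : ∀ {a b c} → a ≤ b → b ≤ c → a ≤ c
_⟫_ = ℤP.≤-trans

≡⇒≤ : ∀ {a b} → a ≡ b → a ≤ b
≡⇒≤ refl = ℤP.≤-refl

pred< : ∀ h → ℤ.pred h < h
pred< h = ℤP.i≤pred[j]⇒i<j ℤP.≤-refl

<suc : ∀ h → h < ℤ.suc h
<suc h = ℤP.suc[i]≤j⇒i<j ℤP.≤-refl

suc-cancel-≤ : ∀ {a b} → ℤ.suc a ≤ ℤ.suc b → a ≤ b
suc-cancel-≤ {a} {b} p = subst₂ _≤_ (ℤP.pred-suc a) (ℤP.pred-suc b) (ℤP.pred-mono p)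

suc≤⇒≤pred : ∀ {a b} → ℤ.suc a ≤ b → a ≤ ℤ.pred b
suc≤⇒≤pred p = ℤP.i<j⇒i≤pred[j] (ℤP.suc[i]≤j⇒i<j p)

oddBound⇒ : ∀ L R → - (+ 2) ≤ L - R → R ≤ ℤ.suc (ℤ.suc L)
oddBound⇒ L R h = subst₂ _≤_ (lhs L R) (rhs L R) (ℤP.+-monoˡ-≤ (R + (1ℤ + 1ℤ)) h)
  where
  lhs : ∀ L R → - (1ℤ + 1ℤ) + (R + (1ℤ + 1ℤ)) ≡ R
  lhs = solve-∀
  rhs : ∀ L R → (L - R) + (R + (1ℤ + 1ℤ)) ≡ 1ℤ + (1ℤ + L)
  rhs = solve-∀

oddBound⇐ : ∀ L R → R ≤ ℤ.suc (ℤ.suc L) → - (+ 2) ≤ L - R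
oddBound⇐ L R h = subst₂ _≤_ (lhs L R) (rhs L R) (ℤP.+-monoˡ-≤ (- (1ℤ + 1ℤ) - R) h)
  where
  lhs : ∀ L R → R + (- (1ℤ + 1ℤ) - R) ≡ - (1ℤ + 1ℤ)
  lhs = solve-∀
  rhs : ∀ L R → (1ℤ + (1ℤ + L)) + (- (1ℤ + 1ℤ) - R) ≡ L - R
  rhs = solve-∀

allOrSome : ∀ {n} (A B : Fin n → Set) → ((i : Fin n) → A i ⊎ B i) →
            ((i : Fin n) → A i) ⊎ Σ (Fin n) B
allOrSome {zero} A B f = inj₁ (λ ())
allOrSome {suc n} A B f
  with f zero | allOrSome (λ i → A (suc i)) (λ i → B (suc i)) (λ i → f (suc i))
... | inj₂ b | _ = inj₂ (zero , b)
... | inj₁ a | inj₂ (i , b) = inj₂ (suc i , b)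
... | inj₁ a | inj₁ g = inj₁ λ { zero → a ; (suc i) → g i }

⧏-viaL : ∀ x {c d yl yr} (i : Fin c) → x ≤ᶜ yl i → x ⧏ᶜ mk c d yl yr
⧏-viaL (mk a b xl xr) i p = inj₁ (i , p)

⧏-viaR : ∀ {a b xl xr} y (j : Fin b) → xr j ≤ᶜ y → mk a b xl xr ⧏ᶜ y
⧏-viaR (mk c d yl yr) j p = inj₂ (j , p)

≤-leftOpt : ∀ {a b xl xr} y → mk a b xl xr ≤ᶜ y → ∀ i → xl i ⧏ᶜ y
≤-leftOpt (mk c d yl yr) p = proj₁ p

≤-rightOpt : ∀ x {c d yl yr} → x ≤ᶜ mk c d yl yr → ∀ j → x ⧏ᶜ yr j
≤-rightOpt (mk a b xl xr) p = proj₂ p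

≤ᶜ-refl : ∀ x → x ≤ᶜ x
≤ᶜ-refl (mk a b xl xr) =
  (λ i → ⧏-viaL (xl i) i (≤ᶜ-refl (xl i))) , (λ j → ⧏-viaR (xr j) j (≤ᶜ-refl (xr j)))

≡ᶜ-refl : ∀ x → x ≡ᶜ x
≡ᶜ-refl x = ≤ᶜ-refl x , ≤ᶜ-refl x

≡ᶜ-sym : ∀ {x y} → x ≡ᶜ y → y ≡ᶜ x
≡ᶜ-sym (p , q) = q , p

mutual
  ≤ᶜ-trans : ∀ x y z → x ≤ᶜ y → y ≤ᶜ z → x ≤ᶜ z
  ≤ᶜ-trans (mk a b xl xr) y@(mk c d yl yr) z@(mk e f zl zr) (p₁ , p₂) q =
    (λ i → ⧏-≤-trans (xl i) y z (p₁ i) q) ,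
    (λ k → ≤-⧏-trans (mk a b xl xr) y (zr k) (p₁ , p₂) (proj₂ q k))

  ⧏-≤-trans : ∀ x y z → x ⧏ᶜ y → y ≤ᶜ z → x ⧏ᶜ z
  ⧏-≤-trans x@(mk a b xl xr) (mk c d yl yr) z@(mk e f zl zr) (inj₁ (i , r)) q =
    ≤-⧏-trans x (yl i) z r (proj₁ q i)
  ⧏-≤-trans (mk a b xl xr) y@(mk c d yl yr) z@(mk e f zl zr) (inj₂ (j , r)) q =
    inj₂ (j , ≤ᶜ-trans (xr j) y z r q)

  ≤-⧏-trans : ∀ x y z → x ≤ᶜ y → y ⧏ᶜ z → x ⧏ᶜ z
  ≤-⧏-trans x@(mk a b xl xr) y@(mk c d yl yr) (mk e f zl zr) p (inj₁ (i , r)) =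
    inj₁ (i , ≤ᶜ-trans x y (zl i) p r)
  ≤-⧏-trans x@(mk a b xl xr) (mk c d yl yr) z@(mk e f zl zr) p (inj₂ (j , r)) =
    ⧏-≤-trans x (yr j) z (proj₂ p j) r

≡ᶜ-trans : ∀ {x y z} → x ≡ᶜ y → y ≡ᶜ z → x ≡ᶜ z
≡ᶜ-trans {x} {y} {z} (p , p') (q , q') = ≤ᶜ-trans x y z p q , ≤ᶜ-trans z y x q' p'

≤-⧏-absurd : ∀ x y → x ≤ᶜ y → y ⧏ᶜ x → ⊥
≤-⧏-absurd (mk a b xl xr) y@(mk c d yl yr) (p₁ , p₂) (inj₁ (i , r)) = ≤-⧏-absurd y (xl i) r (p₁ i)
≤-⧏-absurd x@(mk a b xl xr) (mk c d yl yr) (p₁ , p₂) (inj₂ (j , r)) = ≤-⧏-absurd (yr j) x r (p₂ j)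

≤-or-⧏ : ∀ x y → x ≤ᶜ y ⊎ y ⧏ᶜ x
≤-or-⧏ x@(mk a b xl xr) y@(mk c d yl yr)
  with allOrSome (λ i → xl i ⧏ᶜ y) (λ i → y ≤ᶜ xl i) (λ i → swap (≤-or-⧏ y (xl i)))
     | allOrSome (λ j → x ⧏ᶜ yr j) (λ j → yr j ≤ᶜ x) (λ j → swap (≤-or-⧏ (yr j) x))
... | inj₁ f | inj₁ g = inj₁ (f , g)
... | inj₂ (i , p) | _ = inj₂ (inj₁ (i , p))
... | inj₁ _ | inj₂ (j , p) = inj₂ (inj₂ (j , p))

≤-byOptions : ∀ {a b xl xr c d yl yr} →
              ((i : Fin a) → Σ (Fin c) λ i' → xl i ≤ᶜ yl i') →
              ((j : Fin d) → Σ (Fin b) λ j' → xr j' ≤ᶜ yr j) →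
              mk a b xl xr ≤ᶜ mk c d yl yr
≤-byOptions {xl = xl} {yr = yr} f g =
  (λ i → ⧏-viaL (xl i) (proj₁ (f i)) (proj₂ (f i))) ,
  (λ j → ⧏-viaR (yr j) (proj₁ (g j)) (proj₂ (g j)))

≡ᶜ-byOptions : ∀ {a b xl xr yl yr} →
               ((i : Fin a) → xl i ≡ᶜ yl i) → ((j : Fin b) → xr j ≡ᶜ yr j) →
               mk a b xl xr ≡ᶜ mk a b yl yr
≡ᶜ-byOptions f g = ≤-byOptions (λ i → i , proj₁ (f i)) (λ j → j , proj₁ (g j)) ,
                   ≤-byOptions (λ i → i , proj₂ (f i)) (λ j → j , proj₂ (g j))

natPG-mono : ∀ {m n} → m ℕ.≤ n → natPG m ≤ᶜ natPG n
natPG-mono {zero} {zero} _ = (λ ()) , (λ ())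
natPG-mono {zero} {suc n} _ = (λ ()) , (λ ())
natPG-mono {suc m} {suc n} (s≤s p) = (λ _ → ⧏-viaL (natPG m) zero (natPG-mono p)) , (λ ())

negNatPG-antimono : ∀ {m n} → m ℕ.≤ n → negNatPG n ≤ᶜ negNatPG m
negNatPG-antimono {zero} {zero} _ = (λ ()) , (λ ())
negNatPG-antimono {zero} {suc n} _ = (λ ()) , (λ ())
negNatPG-antimono {suc m} {suc n} (s≤s p) =
  (λ ()) , (λ _ → ⧏-viaR (negNatPG m) zero (negNatPG-antimono p))

negNatPG≤natPG : ∀ m n → negNatPG m ≤ᶜ natPG n
negNatPG≤natPG zero zero = (λ ()) , (λ ())
negNatPG≤natPG zero (suc n) = (λ ()) , (λ ())
negNatPG≤natPG (suc m) zero = (λ ()) , (λ ())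
negNatPG≤natPG (suc m) (suc n) = (λ ()) , (λ ())

intPG-mono : ∀ {a b} → a ≤ b → intPG a ≤ᶜ intPG b
intPG-mono (ℤ.-≤- n≤m) = negNatPG-antimono (s≤s n≤m)
intPG-mono (ℤ.-≤+ {m} {n}) = negNatPG≤natPG (suc m) n
intPG-mono (ℤ.+≤+ p) = natPG-mono p

intPG-strict : ∀ {a b} → a < b → intPG a ⧏ᶜ intPG b
intPG-strict (ℤ.-<- {m} {n} n<m) = ⧏-viaR (negNatPG (suc n)) zero (negNatPG-antimono n<m)
intPG-strict (ℤ.-<+ {m} {n}) = ⧏-viaR (natPG n) zero (negNatPG≤natPG m n)
intPG-strict (ℤ.+<+ {m} {suc n} (s≤s p)) = ⧏-viaL (natPG m) zero (natPG-mono p)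

intPG-reflects-≤ : ∀ {a b} → intPG a ≤ᶜ intPG b → a ≤ b
intPG-reflects-≤ {a} {b} p with a ℤP.≤? b
... | yes q = q
... | no q = ⊥-elim (≤-⧏-absurd (intPG a) (intPG b) p (intPG-strict (ℤP.≰⇒> q)))

intPG-reflects-< : ∀ {a b} → intPG a ⧏ᶜ intPG b → a < b
intPG-reflects-< {a} {b} p with a ℤP.<? b
... | yes q = q
... | no q = ⊥-elim (≤-⧏-absurd (intPG b) (intPG a) (intPG-mono (ℤP.≮⇒≥ q)) p)

intPG-cong : ∀ {a b} → a ≡ b → intPG a ≡ᶜ intPG b
intPG-cong {a} refl = ≡ᶜ-refl (intPG a)

intPG-suc-neg : ∀ n → intPG (ℤ.suc -[1+ n ]) ≡ negNatPG n
intPG-suc-neg zero = refl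
intPG-suc-neg (suc n) = refl

-- k ⧏ y holds via a left option of y, or (for negative k, whose only option
-- is the right option k+1) because k+1 ≤ y; stated as an eliminator.
int⧏-elim : ∀ k {c d yl yr} {C : Set} → intPG k ⧏ᶜ mk c d yl yr →
            ((i : Fin c) → intPG k ≤ᶜ yl i → C) → (intPG (ℤ.suc k) ≤ᶜ mk c d yl yr → C) → C
int⧏-elim (+ zero) (inj₁ (i , p)) viaLeft viaSuc = viaLeft i p
int⧏-elim (+ suc n) (inj₁ (i , p)) viaLeft viaSuc = viaLeft i p
int⧏-elim -[1+ n ] (inj₁ (i , p)) viaLeft viaSuc = viaLeft i p
int⧏-elim -[1+ n ] {c} {d} {yl} {yr} (inj₂ (zero , p)) viaLeft viaSuc =
  viaSuc (subst (_≤ᶜ mk c d yl yr) (sym (intPG-suc-neg n)) p)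

-- Dually, x ⧏ k holds via a right option of x, or (for positive k) x ≤ k-1.
⧏int-elim : ∀ {a b xl xr} k {C : Set} → mk a b xl xr ⧏ᶜ intPG k →
            ((j : Fin b) → xr j ≤ᶜ intPG k → C) → (mk a b xl xr ≤ᶜ intPG (ℤ.pred k) → C) → C
⧏int-elim (+ zero) (inj₂ (j , p)) viaRight viaPred = viaRight j p
⧏int-elim (+ suc n) (inj₁ (zero , p)) viaRight viaPred = viaPred p
⧏int-elim (+ suc n) (inj₂ (j , p)) viaRight viaPred = viaRight j p
⧏int-elim -[1+ n ] (inj₂ (j , p)) viaRight viaPred = viaRight j p

int≤-intro : ∀ k {c d yl yr} → ((j : Fin d) → intPG k ⧏ᶜ yr j) →
             (0ℤ < k → intPG (ℤ.pred k) ⧏ᶜ mk c d yl yr) → intPG k ≤ᶜ mk c d yl yr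
int≤-intro (+ zero) f g = (λ ()) , f
int≤-intro (+ suc n) f g = (λ _ → g (ℤ.+<+ (s≤s z≤n))) , f
int≤-intro -[1+ n ] f g = (λ ()) , f

≤int-intro : ∀ k {a b xl xr} → ((i : Fin a) → xl i ⧏ᶜ intPG k) →
             (k < 0ℤ → mk a b xl xr ⧏ᶜ intPG (ℤ.suc k)) → mk a b xl xr ≤ᶜ intPG k
≤int-intro (+ zero) f g = f , (λ ())
≤int-intro (+ suc n) f g = f , (λ ())
≤int-intro -[1+ n ] {a} {b} {xl} {xr} f g =
  f , (λ _ → subst (mk a b xl xr ⧏ᶜ_) (intPG-suc-neg n) (g ℤ.-<+))

int-byOptions : ∀ {a b xl xr} h →
                (∀ i → xl i ≡ᶜ intPG (ℤ.pred h)) → (∀ j → xr j ≡ᶜ intPG (ℤ.suc h)) →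
                (0ℤ < h → Fin a) → (h < 0ℤ → Fin b) → mk a b xl xr ≡ᶜ intPG h
int-byOptions {xl = xl} {xr} h fl fr hl hr =
  ≤int-intro h (λ i → ≤-⧏-trans (xl i) (intPG (ℤ.pred h)) (intPG h) (proj₁ (fl i)) (intPG-strict (pred< h)))
    (λ h<0 → ⧏-viaR (intPG (ℤ.suc h)) (hr h<0) (proj₁ (fr (hr h<0)))) ,
  int≤-intro h (λ j → ⧏-≤-trans (intPG h) (intPG (ℤ.suc h)) (xr j) (intPG-strict (<suc h)) (proj₂ (fr j)))
    (λ 0<h → ⧏-viaL (intPG (ℤ.pred h)) (hl 0<h) (proj₂ (fl (hl 0<h))))

maxF-ub : ∀ m (f : Fin (suc m) → ℤ) i → f i ≤ maxF m f
maxF-ub zero f zero = ℤP.≤-refl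
maxF-ub (suc m) f zero = ℤP.i≤i⊔j _ _
maxF-ub (suc m) f (suc i) = maxF-ub m (λ k → f (suc k)) i ⟫ ℤP.i≤j⊔i _ _

maxF-lub : ∀ m (f : Fin (suc m) → ℤ) c → (∀ i → f i ≤ c) → maxF m f ≤ c
maxF-lub zero f c h = h zero
maxF-lub (suc m) f c h = ℤP.⊔-lub (h zero) (maxF-lub m (λ k → f (suc k)) c (λ i → h (suc i)))

maxF-arg : ∀ m (f : Fin (suc m) → ℤ) → Σ (Fin (suc m)) λ i → maxF m f ≡ f i
maxF-arg zero f = zero , refl
maxF-arg (suc m) f with ℤP.⊔-sel (f zero) (maxF m (λ k → f (suc k)))
... | inj₁ e = zero , e
... | inj₂ e with maxF-arg m (λ k → f (suc k))
... | i , e' = suc i , trans e e'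

maxF-cong : ∀ m {f g : Fin (suc m) → ℤ} → (∀ i → f i ≡ g i) → maxF m f ≡ maxF m g
maxF-cong zero h = h zero
maxF-cong (suc m) h = cong₂ _⊔_ (h zero) (maxF-cong m (λ i → h (suc i)))

maxF-+ : ∀ m a (f : Fin (suc m) → ℤ) → maxF m (λ i → a + f i) ≡ a + maxF m f
maxF-+ zero a f = refl
maxF-+ (suc m) a f = trans (cong ((a + f zero) ⊔_) (maxF-+ m a (λ k → f (suc k))))
  (sym (ℤP.mono-<-distrib-⊔ (λ x → a + x) (ℤP.+-monoʳ-< a) (f zero) _))

minF-lb : ∀ m (f : Fin (suc m) → ℤ) i → minF m f ≤ f i
minF-lb zero f zero = ℤP.≤-refl
minF-lb (suc m) f zero = ℤP.i⊓j≤i _ _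
minF-lb (suc m) f (suc i) = ℤP.i⊓j≤j _ _ ⟫ minF-lb m (λ k → f (suc k)) i

minF-glb : ∀ m (f : Fin (suc m) → ℤ) c → (∀ i → c ≤ f i) → c ≤ minF m f
minF-glb zero f c h = h zero
minF-glb (suc m) f c h = ℤP.⊓-glb (h zero) (minF-glb m (λ k → f (suc k)) c (λ i → h (suc i)))

minF-arg : ∀ m (f : Fin (suc m) → ℤ) → Σ (Fin (suc m)) λ i → minF m f ≡ f i
minF-arg zero f = zero , refl
minF-arg (suc m) f with ℤP.⊓-sel (f zero) (minF m (λ k → f (suc k)))
... | inj₁ e = zero , e
... | inj₂ e with minF-arg m (λ k → f (suc k))
... | i , e' = suc i , trans e e'

minF-cong : ∀ m {f g : Fin (suc m) → ℤ} → (∀ i → f i ≡ g i) → minF m f ≡ minF m g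
minF-cong zero h = h zero
minF-cong (suc m) h = cong₂ _⊓_ (h zero) (minF-cong m (λ i → h (suc i)))

minF-+ : ∀ m a (f : Fin (suc m) → ℤ) → minF m (λ i → a + f i) ≡ a + minF m f
minF-+ zero a f = refl
minF-+ (suc m) a f = trans (cong ((a + f zero) ⊓_) (minF-+ m a (λ k → f (suc k))))
  (sym (ℤP.mono-<-distrib-⊓ (λ x → a + x) (ℤP.+-monoʳ-< a) (f zero) _))

[,]-↑ˡ : ∀ {a c} {A : Set} (f : Fin a → A) (g : Fin c → A) k → [ f , g ] (splitAt a (k ↑ˡ c)) ≡ f k
[,]-↑ˡ {a} {c} f g k = cong [ f , g ] (splitAt-↑ˡ a k c)

[,]-↑ʳ : ∀ {a c} {A : Set} (f : Fin a → A) (g : Fin c → A) k → [ f , g ] (splitAt a (a ↑ʳ k)) ≡ g k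
[,]-↑ʳ {a} {c} f g k = cong [ f , g ] (splitAt-↑ʳ a c k)

[,]-all : ∀ {a c} {A : Set} (P : A → Set) (f : Fin a → A) (g : Fin c → A) →
          (∀ k → P (f k)) → (∀ k → P (g k)) → ∀ i → P ([ f , g ] (splitAt a i))
[,]-all {a} P f g pf pg i = [_,_] {C = λ s → P ([ f , g ] s)} pf pg (splitAt a i)

data LeftOpt : Game → Game → Set where
  leftOpt : ∀ {m n l r} (i : Fin (suc m)) → LeftOpt (node m n l r) (l i)

data RightOpt : Game → Game → Set where
  rightOpt : ∀ {m n l r} (j : Fin (suc n)) → RightOpt (node m n l r) (r j)

data IsNode : Game → Set where
  isNode : ∀ {m n l r} → IsNode (node m n l r)

≤maxF-witness : ∀ m (f : Fin (suc m) → ℤ) {c} → c ≤ maxF m f → Σ (Fin (suc m)) λ i → c ≤ f i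
≤maxF-witness m f p = let (i , e) = maxF-arg m f in i , (p ⟫ ≡⇒≤ e)

minF≤-witness : ∀ m (f : Fin (suc m) → ℤ) {c} → minF m f ≤ c → Σ (Fin (suc m)) λ i → f i ≤ c
minF≤-witness m f p = let (i , e) = minF-arg m f in i , (≡⇒≤ (sym e) ⟫ p)

Lo-leftOptL : ∀ {G G'} X → LeftOpt G G' → Ro (G' ⊞ X) ≤ Lo (G ⊞ X)
Lo-leftOptL (num b) (leftOpt {m} i) = maxF-ub m _ i
Lo-leftOptL X@(node m' _ _ _) (leftOpt {m} {l = l} i) =
  ≡⇒≤ (cong Ro (sym ([,]-↑ˡ (λ k → l k ⊞ X) _ i))) ⟫ maxF-ub (m ℕ.+ suc m') _ (i ↑ˡ suc m')

Lo-leftOptR : ∀ G {X X'} → LeftOpt X X' → Ro (G ⊞ X') ≤ Lo (G ⊞ X)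
Lo-leftOptR (num a) (leftOpt {m} i) = maxF-ub m _ i
Lo-leftOptR G@(node m _ l _) {X} (leftOpt {m'} {l = l'} i) =
  ≡⇒≤ (cong Ro (sym ([,]-↑ʳ {suc m} (λ k → l k ⊞ X) (λ k → G ⊞ l' k) i))) ⟫
  maxF-ub (m ℕ.+ suc m') _ (suc m ↑ʳ i)

Ro-rightOptL : ∀ {G G'} X → RightOpt G G' → Ro (G ⊞ X) ≤ Lo (G' ⊞ X)
Ro-rightOptL (num b) (rightOpt {n = n} j) = minF-lb n _ j
Ro-rightOptL X@(node _ n' _ _) (rightOpt {n = n} {r = r} j) =
  minF-lb (n ℕ.+ suc n') _ (j ↑ˡ suc n') ⟫ ≡⇒≤ (cong Lo ([,]-↑ˡ (λ k → r k ⊞ X) _ j))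

Ro-rightOptR : ∀ G {X X'} → RightOpt X X' → Ro (G ⊞ X) ≤ Lo (G ⊞ X')
Ro-rightOptR (num a) (rightOpt {n = n} j) = minF-lb n _ j
Ro-rightOptR G@(node _ n _ r) {X} (rightOpt {n = n'} {r = r'} j) =
  minF-lb (n ℕ.+ suc n') _ (suc n ↑ʳ j) ⟫
  ≡⇒≤ (cong Lo ([,]-↑ʳ {suc n} (λ k → r k ⊞ X) (λ k → G ⊞ r' k) j))

Lo-≤ : ∀ G X c → IsNode G ⊎ IsNode X →
       (∀ {G'} → LeftOpt G G' → Ro (G' ⊞ X) ≤ c) →
       (∀ {X'} → LeftOpt X X' → Ro (G ⊞ X') ≤ c) → Lo (G ⊞ X) ≤ c
Lo-≤ (num a) (num b) c (inj₁ ()) f g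
Lo-≤ (num a) (num b) c (inj₂ ()) f g
Lo-≤ (num a) (node m n l r) c _ f g = maxF-lub m _ c (λ i → g (leftOpt i))
Lo-≤ (node m n l r) (num b) c _ f g = maxF-lub m _ c (λ i → f (leftOpt i))
Lo-≤ (node m n l r) X@(node m' n' l' r') c _ f g =
  maxF-lub (m ℕ.+ suc m') _ c
    ([,]-all (λ z → Ro z ≤ c) (λ k → l k ⊞ X) (λ k → node m n l r ⊞ l' k)
       (λ k → f (leftOpt k)) (λ k → g (leftOpt k)))

≤-Ro : ∀ G X c → IsNode G ⊎ IsNode X →
       (∀ {G'} → RightOpt G G' → c ≤ Lo (G' ⊞ X)) →
       (∀ {X'} → RightOpt X X' → c ≤ Lo (G ⊞ X')) → c ≤ Ro (G ⊞ X)
≤-Ro (num a) (num b) c (inj₁ ()) f g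
≤-Ro (num a) (num b) c (inj₂ ()) f g
≤-Ro (num a) (node m n l r) c _ f g = minF-glb n _ c (λ i → g (rightOpt i))
≤-Ro (node m n l r) (num b) c _ f g = minF-glb n _ c (λ i → f (rightOpt i))
≤-Ro (node m n l r) X@(node m' n' l' r') c _ f g =
  minF-glb (n ℕ.+ suc n') _ c
    ([,]-all (λ z → c ≤ Lo z) (λ k → r k ⊞ X) (λ k → node m n l r ⊞ r' k)
       (λ k → f (rightOpt k)) (λ k → g (rightOpt k)))

mutual
  Lo-shiftˡ : ∀ a K → Lo (num a ⊞ K) ≡ a + Lo K
  Lo-shiftˡ a (num b) = refl
  Lo-shiftˡ a (node m n l r) =
    trans (maxF-cong m (λ i → Ro-shiftˡ a (l i))) (maxF-+ m a (λ i → Ro (l i)))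

  Ro-shiftˡ : ∀ a K → Ro (num a ⊞ K) ≡ a + Ro K
  Ro-shiftˡ a (num b) = refl
  Ro-shiftˡ a (node m n l r) =
    trans (minF-cong n (λ i → Lo-shiftˡ a (r i))) (minF-+ n a (λ i → Lo (r i)))

mutual
  Lo-shiftʳ : ∀ a K → Lo (K ⊞ num a) ≡ a + Lo K
  Lo-shiftʳ a (num b) = ℤP.+-comm b a
  Lo-shiftʳ a (node m n l r) =
    trans (maxF-cong m (λ i → Ro-shiftʳ a (l i))) (maxF-+ m a (λ i → Ro (l i)))

  Ro-shiftʳ : ∀ a K → Ro (K ⊞ num a) ≡ a + Ro K
  Ro-shiftʳ a (num b) = ℤP.+-comm b a
  Ro-shiftʳ a (node m n l r) =
    trans (minF-cong n (λ i → Lo-shiftʳ a (r i))) (minF-+ n a (λ i → Lo (r i)))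

Lo-+0 : ∀ K → Lo (K ⊞ num 0ℤ) ≡ Lo K
Lo-+0 K = trans (Lo-shiftʳ 0ℤ K) (ℤP.+-identityˡ (Lo K))

-- The strict forms k ⧏ ψ H, ψ H ⧏ k for games of the other parity are
-- needed along the way, since the options of G have the other parity.

oddSpread : ∀ {G} → I₋₂ odd G → Ro G ≤ ℤ.suc (ℤ.suc (Lo G))
oddSpread {G} (iodd _ _ c) = oddBound⇒ (Lo G) (Ro G) c

I-leftOpts : ∀ {p m n l r} → I₋₂ p (node m n l r) → ∀ i → I₋₂ (flip p) (l i)
I-leftOpts (ieven fl _ _) = fl
I-leftOpts (iodd fl _ _) = fl

I-rightOpts : ∀ {p m n l r} → I₋₂ p (node m n l r) → ∀ j → I₋₂ (flip p) (r j)
I-rightOpts (ieven _ fr _) = fr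
I-rightOpts (iodd _ fr _) = fr

mutual
  int≤ψ⇒Ro-even : ∀ {G} k → I₋₂ even G → intPG k ≤ᶜ ψ G → k ≤ Ro G
  int≤ψ⇒Ro-even k (inum a) p = intPG-reflects-≤ p
  int≤ψ⇒Ro-even {node m n l r} k (ieven _ fr _) p =
    minF-glb n _ _ (λ j → int⧏ψ⇒Lo-odd k (fr j) (≤-rightOpt (intPG k) p j))

  int⧏ψ⇒Lo-odd : ∀ {H} k → I₋₂ odd H → intPG k ⧏ᶜ ψ H → k ≤ Lo H
  int⧏ψ⇒Lo-odd {node m n l r} k d@(iodd fl _ _) p =
    int⧏-elim k p
      (λ i q → int≤ψ⇒Ro-even k (fl i) q ⟫ maxF-ub m _ i)
      (λ q → suc-cancel-≤ (suc-cancel-≤ (int≤ψ⇒Ro-odd (ℤ.suc k) d q ⟫ oddSpread d)))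

  int≤ψ⇒Ro-odd : ∀ {G} k → I₋₂ odd G → intPG k ≤ᶜ ψ G → ℤ.suc k ≤ Ro G
  int≤ψ⇒Ro-odd {node m n l r} k (iodd _ fr _) p =
    minF-glb n _ _ (λ j → int⧏ψ⇒Lo-even k (fr j) (≤-rightOpt (intPG k) p j))

  int⧏ψ⇒Lo-even : ∀ {H} k → I₋₂ even H → intPG k ⧏ᶜ ψ H → ℤ.suc k ≤ Lo H
  int⧏ψ⇒Lo-even k (inum a) p = ℤP.i<j⇒suc[i]≤j (intPG-reflects-< {k} {a} p)
  int⧏ψ⇒Lo-even {node m n l r} k d@(ieven fl _ c) p =
    int⧏-elim k p
      (λ i q → int≤ψ⇒Ro-odd k (fl i) q ⟫ maxF-ub m _ i)
      (λ q → int≤ψ⇒Ro-even (ℤ.suc k) d q ⟫ c)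

mutual
  ψ≤int⇒Lo-even : ∀ {G} k → I₋₂ even G → ψ G ≤ᶜ intPG k → Lo G ≤ k
  ψ≤int⇒Lo-even k (inum a) p = intPG-reflects-≤ p
  ψ≤int⇒Lo-even {node m n l r} k (ieven fl _ _) p =
    maxF-lub m _ _ (λ i → ψ⧏int⇒Ro-odd k (fl i) (≤-leftOpt (intPG k) p i))

  ψ⧏int⇒Ro-odd : ∀ {H} k → I₋₂ odd H → ψ H ⧏ᶜ intPG k → Ro H ≤ k
  ψ⧏int⇒Ro-odd {node m n l r} k d@(iodd _ fr _) p =
    ⧏int-elim k p
      (λ j q → minF-lb n _ j ⟫ ψ≤int⇒Lo-even k (fr j) q)
      (λ q → oddSpread d ⟫ ℤP.suc-mono (ψ≤int⇒Lo-odd (ℤ.pred k) d q) ⟫ ≡⇒≤ (ℤP.suc-pred k))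

  ψ≤int⇒Lo-odd : ∀ {G} k → I₋₂ odd G → ψ G ≤ᶜ intPG k → ℤ.suc (Lo G) ≤ k
  ψ≤int⇒Lo-odd {node m n l r} k (iodd fl _ _) p =
    ℤP.suc-mono (maxF-lub m _ _ λ i →
      suc≤⇒≤pred (ψ⧏int⇒Ro-even k (fl i) (≤-leftOpt (intPG k) p i))) ⟫ ≡⇒≤ (ℤP.suc-pred k)

  ψ⧏int⇒Ro-even : ∀ {H} k → I₋₂ even H → ψ H ⧏ᶜ intPG k → ℤ.suc (Ro H) ≤ k
  ψ⧏int⇒Ro-even k (inum a) p = ℤP.i<j⇒suc[i]≤j (intPG-reflects-< {a} {k} p)
  ψ⧏int⇒Ro-even {node m n l r} k d@(ieven _ fr c) p =
    ⧏int-elim k p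
      (λ j q → ℤP.suc-mono (minF-lb n _ j) ⟫ ψ≤int⇒Lo-odd k (fr j) q)
      (λ q → ℤP.suc-mono (c ⟫ ψ≤int⇒Lo-even (ℤ.pred k) d q) ⟫ ≡⇒≤ (ℤP.suc-pred k))

mutual
  Ro⇒int≤ψ-even : ∀ {G} k → I₋₂ even G → k ≤ Ro G → intPG k ≤ᶜ ψ G
  Ro⇒int≤ψ-even k (inum a) p = intPG-mono p
  Ro⇒int≤ψ-even {node m n l r} k (ieven fl fr c) p =
    int≤-intro k (λ j → Lo⇒int⧏ψ-odd k (fr j) (p ⟫ minF-lb n _ j))
      (λ _ → let (i , q) = ≤maxF-witness m _ (≡⇒≤ (ℤP.suc-pred k) ⟫ p ⟫ c)
             in ⧏-viaL (intPG (ℤ.pred k)) i (Ro⇒int≤ψ-odd (ℤ.pred k) (fl i) q))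

  Lo⇒int⧏ψ-odd : ∀ {H} k → I₋₂ odd H → k ≤ Lo H → intPG k ⧏ᶜ ψ H
  Lo⇒int⧏ψ-odd {node m n l r} k (iodd fl _ _) p =
    let (i , q) = ≤maxF-witness m _ p
    in ⧏-viaL (intPG k) i (Ro⇒int≤ψ-even k (fl i) q)

  Ro⇒int≤ψ-odd : ∀ {G} k → I₋₂ odd G → ℤ.suc k ≤ Ro G → intPG k ≤ᶜ ψ G
  Ro⇒int≤ψ-odd {node m n l r} k d@(iodd fl fr _) p =
    int≤-intro k (λ j → Lo⇒int⧏ψ-even k (fr j) (p ⟫ minF-lb n _ j))
      (λ _ → let (i , q) = ≤maxF-witness m _ (pred≤Lo (p ⟫ oddSpread d))
             in ⧏-viaL (intPG (ℤ.pred k)) i (Ro⇒int≤ψ-even (ℤ.pred k) (fl i) q))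
    where
    pred≤Lo : ∀ {L} → ℤ.suc k ≤ ℤ.suc (ℤ.suc L) → ℤ.pred k ≤ L
    pred≤Lo {L} h = ℤP.pred-mono (suc-cancel-≤ {k} {ℤ.suc L} h) ⟫ ≡⇒≤ (ℤP.pred-suc L)

  Lo⇒int⧏ψ-even : ∀ {H} k → I₋₂ even H → ℤ.suc k ≤ Lo H → intPG k ⧏ᶜ ψ H
  Lo⇒int⧏ψ-even k (inum a) p = intPG-strict {k} {a} (ℤP.suc[i]≤j⇒i<j p)
  Lo⇒int⧏ψ-even {node m n l r} k (ieven fl _ _) p =
    let (i , q) = ≤maxF-witness m _ p
    in ⧏-viaL (intPG k) i (Ro⇒int≤ψ-odd k (fl i) q)

mutual
  Lo⇒ψ≤int-even : ∀ {G} k → I₋₂ even G → Lo G ≤ k → ψ G ≤ᶜ intPG k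
  Lo⇒ψ≤int-even k (inum a) p = intPG-mono p
  Lo⇒ψ≤int-even {node m n l r} k (ieven fl fr c) p =
    ≤int-intro k (λ i → Ro⇒ψ⧏int-odd k (fl i) (maxF-ub m _ i ⟫ p))
      (λ _ → let (j , q) = minF≤-witness n _ (c ⟫ p)
             in ⧏-viaR (intPG (ℤ.suc k)) j (Lo⇒ψ≤int-odd (ℤ.suc k) (fr j) (ℤP.suc-mono q)))

  Ro⇒ψ⧏int-odd : ∀ {H} k → I₋₂ odd H → Ro H ≤ k → ψ H ⧏ᶜ intPG k
  Ro⇒ψ⧏int-odd {node m n l r} k (iodd _ fr _) p =
    let (j , q) = minF≤-witness n _ p
    in ⧏-viaR (intPG k) j (Lo⇒ψ≤int-even k (fr j) q)

  Lo⇒ψ≤int-odd : ∀ {G} k → I₋₂ odd G → ℤ.suc (Lo G) ≤ k → ψ G ≤ᶜ intPG k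
  Lo⇒ψ≤int-odd {node m n l r} k d@(iodd fl fr _) p =
    ≤int-intro k (λ i → Ro⇒ψ⧏int-even k (fl i) (ℤP.suc-mono (maxF-ub m _ i) ⟫ p))
      (λ _ → let (j , q) = minF≤-witness n _ (oddSpread d ⟫ ℤP.suc-mono p)
             in ⧏-viaR (intPG (ℤ.suc k)) j (Lo⇒ψ≤int-even (ℤ.suc k) (fr j) q))

  Ro⇒ψ⧏int-even : ∀ {H} k → I₋₂ even H → ℤ.suc (Ro H) ≤ k → ψ H ⧏ᶜ intPG k
  Ro⇒ψ⧏int-even k (inum a) p = intPG-strict {a} {k} (ℤP.suc[i]≤j⇒i<j p)
  Ro⇒ψ⧏int-even {node m n l r} k (ieven _ fr _) p =
    let (j , q) = minF≤-witness n _ ℤP.≤-refl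
    in ⧏-viaR (intPG k) j (Lo⇒ψ≤int-odd k (fr j) (ℤP.suc-mono q ⟫ p))

int⧏ψ-leftOpt : ∀ {m n l r} k → I₋₂ odd (node m n l r) → intPG k ⧏ᶜ ψ (node m n l r) →
                Σ (Fin (suc m)) λ i → intPG k ≤ᶜ ψ (l i)
int⧏ψ-leftOpt {m} k d@(iodd fl _ _) q =
  let (i , p) = ≤maxF-witness m _ (int⧏ψ⇒Lo-odd k d q)
  in i , Ro⇒int≤ψ-even k (fl i) p

ψ⧏int-rightOpt : ∀ {m n l r} k → I₋₂ odd (node m n l r) → ψ (node m n l r) ⧏ᶜ intPG k →
                 Σ (Fin (suc n)) λ j → ψ (r j) ≤ᶜ intPG k
ψ⧏int-rightOpt {n = n} k d@(iodd _ fr _) q =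
  let (j , p) = minF≤-witness n _ (ψ⧏int⇒Ro-odd k d q)
  in j , Lo⇒ψ≤int-even k (fr j) p

≤Lo-shift : ∀ {g x} K → g ≤ Lo K → g + x ≤ Lo (K ⊞ num x)
≤Lo-shift {g} {x} K h = ≡⇒≤ (ℤP.+-comm g x) ⟫ ℤP.+-monoʳ-≤ x h ⟫ ≡⇒≤ (sym (Lo-shiftʳ x K))

Ro≤-shift : ∀ {h x} K → Ro K ≤ h → Ro (K ⊞ num x) ≤ h + x
Ro≤-shift {h} {x} K q = ≡⇒≤ (Ro-shiftʳ x K) ⟫ ℤP.+-monoʳ-≤ x q ⟫ ≡⇒≤ (ℤP.+-comm x h)

-- By induction,
-- every move of Left in G + X is answered in H + X: moves in X by the
-- induction hypothesis, a move to G^L + X by comparing G^L with H, where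
-- ψ G^L ⧏ ψ H supplies either a left option of H or a right option of G^L.
mutual
  ψ≤⇒Lo≤ : ∀ {p G H} → I₋₂ p G → I₋₂ p H → ψ G ≤ᶜ ψ H → ∀ X → Lo (G ⊞ X) ≤ Lo (H ⊞ X)
  ψ≤⇒Lo≤ (inum g) (inum h) le (num x) = ≤Lo-shift (num h) (intPG-reflects-≤ {g} {h} le)
  ψ≤⇒Lo≤ (inum g) dH@(ieven {m} {n} {l} {r} _ _ c) le (num x) =
    ≤Lo-shift (node m n l r) (int≤ψ⇒Ro-even g dH le ⟫ c)
  ψ≤⇒Lo≤ dG@(inum g) dH le X@(node _ _ _ _) =
    Lo-≤ (num g) X _ (inj₂ isNode) (λ ()) (Lo≤-leftX dG dH le X)
  ψ≤⇒Lo≤ {G = G@(node _ _ _ _)} dG dH le X =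
    Lo-≤ G X _ (inj₁ isNode) (Lo≤-leftG dG dH le X) (Lo≤-leftX dG dH le X)

  Lo≤-leftX : ∀ {p G H} → I₋₂ p G → I₋₂ p H → ψ G ≤ᶜ ψ H → ∀ X {X'} → LeftOpt X X' →
              Ro (G ⊞ X') ≤ Lo (H ⊞ X)
  Lo≤-leftX {H = H} dG dH le (node _ _ l _) (leftOpt i) =
    ψ≤⇒Ro≤ dG dH le (l i) ⟫ Lo-leftOptR H (leftOpt i)

  Lo≤-leftG : ∀ {p G H} → I₋₂ p G → I₋₂ p H → ψ G ≤ᶜ ψ H → ∀ X {G'} → LeftOpt G G' →
              Ro (G' ⊞ X) ≤ Lo (H ⊞ X)
  Lo≤-leftG {H = H} (ieven fl _ _) dH le X (leftOpt i) = ψ⧏⇒Ro≤Lo (fl i) dH (≤-leftOpt (ψ H) le i) X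
  Lo≤-leftG {H = H} (iodd fl _ _) dH le X (leftOpt i) = ψ⧏⇒Ro≤Lo (fl i) dH (≤-leftOpt (ψ H) le i) X

  ψ≤⇒Ro≤ : ∀ {p G H} → I₋₂ p G → I₋₂ p H → ψ G ≤ᶜ ψ H → ∀ X → Ro (G ⊞ X) ≤ Ro (H ⊞ X)
  ψ≤⇒Ro≤ (inum g) (inum h) le (num x) = Ro≤-shift (num g) (intPG-reflects-≤ {g} {h} le)
  ψ≤⇒Ro≤ dG@(ieven {m} {n} {l} {r} _ _ c) (inum h) le (num x) =
    Ro≤-shift (node m n l r) (c ⟫ ψ≤int⇒Lo-even h dG le)
  ψ≤⇒Ro≤ dG dH@(inum h) le X@(node _ _ _ _) =
    ≤-Ro (num h) X _ (inj₂ isNode) (λ ()) (Ro≤-rightX dG dH le X)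
  ψ≤⇒Ro≤ {H = H@(node _ _ _ _)} dG dH le X =
    ≤-Ro H X _ (inj₁ isNode) (Ro≤-rightH dG dH le X) (Ro≤-rightX dG dH le X)

  Ro≤-rightX : ∀ {p G H} → I₋₂ p G → I₋₂ p H → ψ G ≤ᶜ ψ H → ∀ X {X'} → RightOpt X X' →
               Ro (G ⊞ X) ≤ Lo (H ⊞ X')
  Ro≤-rightX {G = G} dG dH le (node _ _ _ r) (rightOpt j) =
    Ro-rightOptR G (rightOpt j) ⟫ ψ≤⇒Lo≤ dG dH le (r j)

  Ro≤-rightH : ∀ {p G H} → I₋₂ p G → I₋₂ p H → ψ G ≤ᶜ ψ H → ∀ X {H'} → RightOpt H H' →
               Ro (G ⊞ X) ≤ Lo (H' ⊞ X)
  Ro≤-rightH {G = G} dG (ieven _ fr _) le X (rightOpt j) = ψ⧏⇒Ro≤Lo dG (fr j) (≤-rightOpt (ψ G) le j) X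
  Ro≤-rightH {G = G} dG (iodd _ fr _) le X (rightOpt j) = ψ⧏⇒Ro≤Lo dG (fr j) (≤-rightOpt (ψ G) le j) X

  ψ⧏⇒Ro≤Lo : ∀ {p A B} → I₋₂ p A → I₋₂ (flip p) B → ψ A ⧏ᶜ ψ B → ∀ X → Ro (A ⊞ X) ≤ Lo (B ⊞ X)
  ψ⧏⇒Ro≤Lo dA@(inum g) dB@(iodd fl' _ _) lt X =
    let (i , le) = int⧏ψ-leftOpt g dB lt
    in ψ≤⇒Ro≤ dA (fl' i) le X ⟫ Lo-leftOptL X (leftOpt i)
  ψ⧏⇒Ro≤Lo dA@(ieven _ _ _) (iodd fl' _ _) (inj₁ (i , le)) X =
    ψ≤⇒Ro≤ dA (fl' i) le X ⟫ Lo-leftOptL X (leftOpt i)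
  ψ⧏⇒Ro≤Lo (ieven _ fr _) dB@(iodd _ _ _) (inj₂ (j , le)) X =
    Ro-rightOptL X (rightOpt j) ⟫ ψ≤⇒Lo≤ (fr j) dB le X
  ψ⧏⇒Ro≤Lo dA@(iodd _ fr _) dB@(inum h) lt X =
    let (j , le) = ψ⧏int-rightOpt h dA lt
    in Ro-rightOptL X (rightOpt j) ⟫ ψ≤⇒Lo≤ (fr j) dB le X
  ψ⧏⇒Ro≤Lo dA@(iodd _ _ _) (ieven fl' _ _) (inj₁ (i , le)) X =
    ψ≤⇒Ro≤ dA (fl' i) le X ⟫ Lo-leftOptL X (leftOpt i)
  ψ⧏⇒Ro≤Lo (iodd _ fr _) dB@(ieven _ _ _) (inj₂ (j , le)) X =
    Ro-rightOptL X (rightOpt j) ⟫ ψ≤⇒Lo≤ (fr j) dB le X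

negate : Game → Game
negate (num a) = num (- a)
negate (node m n l r) = node n m (λ j → negate (r j)) (λ i → negate (l i))

I⇒wellTempered : ∀ {k p G} → I k p G → WellTempered p G
I⇒wellTempered (inum a) = wnum a
I⇒wellTempered (ieven fl fr _) = wnode (λ i → I⇒wellTempered (fl i)) (λ j → I⇒wellTempered (fr j))
I⇒wellTempered (iodd fl fr _) = wnode (λ i → I⇒wellTempered (fl i)) (λ j → I⇒wellTempered (fr j))

negate-wellTempered : ∀ {p G} → WellTempered p G → WellTempered p (negate G)
negate-wellTempered (wnum a) = wnum (- a)
negate-wellTempered (wnode fl fr) = wnode (λ j → negate-wellTempered (fr j)) (λ i → negate-wellTempered (fl i))

data Shadows (c d : ℤ) : Game → Game → Set where
  leaf : ∀ {G} h → Lo (G ⊞ num (- h)) ≤ c → d ≤ Ro (G ⊞ num (- h)) → Shadows c d G (num h)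
  node : ∀ {m n l r l' r'} → (∀ i → Shadows c d (l i) (l' i)) → (∀ j → Shadows c d (r j) (r' j)) →
         Shadows c d (node m n l r) (node m n l' r')

-- Mirror strategy: in G - H, the second player copies each move into the
-- corresponding component, which keeps the outcome within the margins.
mutual
  shadow-Lo : ∀ {c d G H} → Shadows c d G H → Lo (G ⊞ negate H) ≤ c
  shadow-Lo (leaf h p _) = p
  shadow-Lo {c} {G = G@(node _ _ l r)} {H@(node _ _ l' r')} (node sl sr) =
    Lo-≤ G (negate H) c (inj₁ isNode)
      (λ { (leftOpt i) → Ro-rightOptR (l i) {negate H} (rightOpt i) ⟫ shadow-Lo (sl i) })
      (λ { (leftOpt j) → Ro-rightOptL (negate (r' j)) (rightOpt j) ⟫ shadow-Lo (sr j) })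

  shadow-Ro : ∀ {c d G H} → Shadows c d G H → d ≤ Ro (G ⊞ negate H)
  shadow-Ro (leaf h _ q) = q
  shadow-Ro {d = d} {G@(node _ _ l r)} {H@(node _ _ l' r')} (node sl sr) =
    ≤-Ro G (negate H) d (inj₁ isNode)
      (λ { (rightOpt j) → shadow-Ro (sr j) ⟫ Lo-leftOptR (r j) {negate H} (leftOpt j) })
      (λ { (rightOpt i) → shadow-Ro (sl i) ⟫ Lo-leftOptL (negate (l' i)) (leftOpt i) })

self-shadow : ∀ H → Shadows 0ℤ 0ℤ H H
self-shadow (num h) = leaf h (≡⇒≤ (ℤP.+-inverseʳ h)) (≡⇒≤ (sym (ℤP.+-inverseʳ h)))
self-shadow (node m n l r) = node (λ i → self-shadow (l i)) (λ j → self-shadow (r j))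

τ : Game → Game
τ (num h) = node 0 0 (λ _ → num (ℤ.pred h)) (λ _ → num (ℤ.suc h))
τ (node m n l r) = node m n (λ i → τ (l i)) (λ j → τ (r j))

ψ-τ : ∀ H → ψ (τ H) ≡ᶜ ψ H
ψ-τ (num h) = int-byOptions h (λ _ → ≡ᶜ-refl _) (λ _ → ≡ᶜ-refl _) (λ _ → zero) (λ _ → zero)
ψ-τ (node m n l r) = ≡ᶜ-byOptions (λ i → ψ-τ (l i)) (λ j → ψ-τ (r j))

mutual
  τ-outcomes-even : ∀ {H} → I₋₂ even H → (Lo (τ H) ≡ ℤ.pred (Lo H)) × (Ro (τ H) ≡ ℤ.suc (Ro H))
  τ-outcomes-even (inum h) = refl , refl
  τ-outcomes-even {node m n l r} (ieven fl fr _) =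
    trans (maxF-cong m (λ i → proj₂ (τ-outcomes-odd (fl i)))) (maxF-+ m -1ℤ (λ i → Ro (l i))) ,
    trans (minF-cong n (λ j → proj₁ (τ-outcomes-odd (fr j)))) (minF-+ n 1ℤ (λ j → Lo (r j)))

  τ-outcomes-odd : ∀ {H} → I₋₂ odd H → (Lo (τ H) ≡ ℤ.suc (Lo H)) × (Ro (τ H) ≡ ℤ.pred (Ro H))
  τ-outcomes-odd {node m n l r} (iodd fl fr _) =
    trans (maxF-cong m (λ i → proj₂ (τ-outcomes-even (fl i)))) (maxF-+ m 1ℤ (λ i → Ro (l i))) ,
    trans (minF-cong n (λ j → proj₁ (τ-outcomes-even (fr j)))) (minF-+ n -1ℤ (λ j → Lo (r j)))

τ-I₋₂ : ∀ {p H} → I₋₂ p H → I₋₂ (flip p) (τ H)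
τ-I₋₂ (inum h) =
  iodd (λ _ → inum (ℤ.pred h)) (λ _ → inum (ℤ.suc h))
       (≡⇒≤ (sym (spread h)))
  where
  spread : ∀ h → (-1ℤ + h) - (1ℤ + h) ≡ - (1ℤ + 1ℤ)
  spread = solve-∀
τ-I₋₂ {H = H@(node _ _ _ _)} d@(ieven fl fr c) =
  iodd (λ i → τ-I₋₂ (fl i)) (λ j → τ-I₋₂ (fr j))
    (oddBound⇐ (Lo (τ H)) (Ro (τ H))
      (≡⇒≤ (proj₂ (τ-outcomes-even d)) ⟫ ℤP.suc-mono c ⟫
       ≡⇒≤ (cong ℤ.suc (sym (ℤP.suc-pred (Lo H)))) ⟫
       ≡⇒≤ (cong (λ z → ℤ.suc (ℤ.suc z)) (sym (proj₁ (τ-outcomes-even d))))))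
τ-I₋₂ {H = H@(node _ _ _ _)} d@(iodd fl fr _) =
  ieven (λ i → τ-I₋₂ (fl i)) (λ j → τ-I₋₂ (fr j))
    (≡⇒≤ (proj₂ (τ-outcomes-odd d)) ⟫ ℤP.pred-mono (oddSpread d) ⟫
     ≡⇒≤ (ℤP.pred-suc _) ⟫ ≡⇒≤ (sym (proj₁ (τ-outcomes-odd d))))

-- τ H shadows H with margins -1, 1: at a leaf, ⟨h-1 | h+1⟩ - h = ⟨-1 | 1⟩.
τ-shadow : ∀ H → Shadows -1ℤ 1ℤ (τ H) H
τ-shadow (num h) = leaf h (≡⇒≤ (down h)) (≡⇒≤ (sym (up h)))
  where
  down : ∀ h → (-1ℤ + h) + (- h) ≡ -1ℤ
  down = solve-∀
  up : ∀ h → (1ℤ + h) + (- h) ≡ 1ℤ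
  up = solve-∀
τ-shadow (node m n l r) = node (λ i → τ-shadow (l i)) (λ j → τ-shadow (r j))

≲⇒Lo≤ : ∀ G H → G ≲ H → Lo G ≤ Lo H
≲⇒Lo≤ G H le = ≡⇒≤ (sym (Lo-+0 G)) ⟫ proj₁ (le even (num 0ℤ) (wnum 0ℤ)) ⟫ ≡⇒≤ (Lo-+0 H)

-- Suppose G ≲ H but ψ H ≤ ψ G' for
-- a left option G' of G.  As τ H has the parity of G' and ψ (τ H) = ψ H,
-- R(G' - H) ≥ R(τ H - H) ≥ 1, so Left moving to G' - H gets
-- L(G - H) ≥ 1, contradicting L(G - H) ≤ L(H - H) ≤ 0.  Dually for a right
-- option H' of H with ψ H' ≤ ψ G.
leftOpt-above-absurd : ∀ {p G H G'} → I₋₂ p H → I₋₂ (flip p) G' → LeftOpt G G' →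
                       ψ H ≤ᶜ ψ G' → G ≲ H → ⊥
leftOpt-above-absurd {p} {H = H} {G'} dH dG' opt above G≲H = 1≰0
  (shadow-Ro (τ-shadow H) ⟫
   ψ≤⇒Ro≤ (τ-I₋₂ dH) dG' (≤ᶜ-trans (ψ (τ H)) (ψ H) (ψ G') (proj₁ (ψ-τ H)) above) (negate H) ⟫
   Lo-leftOptL (negate H) opt ⟫
   proj₁ (G≲H p (negate H) (negate-wellTempered (I⇒wellTempered dH))) ⟫
   shadow-Lo (self-shadow H))
  where
  1≰0 : 1ℤ ≤ 0ℤ → ⊥
  1≰0 (ℤ.+≤+ ())

rightOpt-below-absurd : ∀ {p G H H'} → I₋₂ p G → I₋₂ (flip p) H' → RightOpt H H' →
                        ψ H' ≤ᶜ ψ G → G ≲ H → ⊥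
rightOpt-below-absurd {p} {G} {H' = H'} dG dH' opt below G≲H = 0≰-1
  (shadow-Ro (self-shadow G) ⟫
   proj₂ (G≲H p (negate G) (negate-wellTempered (I⇒wellTempered dG))) ⟫
   Ro-rightOptL (negate G) opt ⟫
   ψ≤⇒Lo≤ dH' (τ-I₋₂ dG) (≤ᶜ-trans (ψ H') (ψ G) (ψ (τ G)) below (proj₂ (ψ-τ G))) (negate G) ⟫
   shadow-Lo (τ-shadow G))
  where
  0≰-1 : 0ℤ ≤ -1ℤ → ⊥
  0≰-1 ()

-- Hence G ≲ H excludes ψ H ⧏ ψ G.  Integers are handled by testing with 0.
≲⇒¬ψ⧏ : ∀ {p G H} → I₋₂ p G → I₋₂ p H → G ≲ H → ψ H ⧏ᶜ ψ G → ⊥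
≲⇒¬ψ⧏ (inum g) (inum h) G≲H lt =
  ℤP.≤⇒≯ (≲⇒Lo≤ (num g) (num h) G≲H) (intPG-reflects-< {h} {g} lt)
≲⇒¬ψ⧏ {H = H} dG@(inum g) dH@(ieven _ fr _) G≲H lt =
  ⧏int-elim g lt
    (λ j below → rightOpt-below-absurd dG (fr j) (rightOpt j) below G≲H)
    (λ below → ℤP.≤⇒≯ (≲⇒Lo≤ (num g) H G≲H ⟫ ψ≤int⇒Lo-even (ℤ.pred g) dH below) (pred< g))
≲⇒¬ψ⧏ {G = G} dG@(ieven fl _ c) dH@(inum h) G≲H lt =
  int⧏-elim h lt
    (λ i above → leftOpt-above-absurd dH (fl i) (leftOpt i) above G≲H)
    (λ above → ℤP.≤⇒≯ (int≤ψ⇒Ro-even (ℤ.suc h) dG above ⟫ c ⟫ ≲⇒Lo≤ G (num h) G≲H) (<suc h))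
≲⇒¬ψ⧏ {G = node _ _ _ _} {node _ _ _ _} dG dH G≲H (inj₁ (i , above)) =
  leftOpt-above-absurd dH (I-leftOpts dG i) (leftOpt i) above G≲H
≲⇒¬ψ⧏ {G = node _ _ _ _} {node _ _ _ _} dG dH G≲H (inj₂ (j , below)) =
  rightOpt-below-absurd dG (I-rightOpts dH j) (rightOpt j) below G≲H

ψ≤⇔≲ : (p : Parity) (G H : Game) → I₋₂ p G → I₋₂ p H →
       (ψ G ≤ᶜ ψ H → G ≲ H) × (G ≲ H → ψ G ≤ᶜ ψ H)
ψ≤⇔≲ p G H dG dH =
  (λ le _ X _ → ψ≤⇒Lo≤ dG dH le X , ψ≤⇒Ro≤ dG dH le X) ,
  (λ G≲H → [ (λ le → le) , (λ lt → ⊥-elim (≲⇒¬ψ⧏ dG dH G≲H lt)) ]′ (≤-or-⧏ (ψ G) (ψ H)))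

-- With the even probe
-- ⟨⟨-N | -N⟩ | ⟨N | N⟩⟩, R(K + probe) is at least N + (least leaf of K) for
-- even K, and at most -N + (largest leaf of K) for odd K, since parity
-- decides who must open the probe; for large N this separates any even G
-- from any odd H.

leafMin : Game → ℤ
leafMin (num a) = a
leafMin (node m n l r) = minF m (λ i → leafMin (l i)) ⊓ minF n (λ j → leafMin (r j))

leafMax : Game → ℤ
leafMax (num a) = a
leafMax (node m n l r) = maxF m (λ i → leafMax (l i)) ⊔ maxF n (λ j → leafMax (r j))

leafMin-left : ∀ {m n l r} i → leafMin (node m n l r) ≤ leafMin (l i)
leafMin-left {m} {l = l} i = ℤP.i⊓j≤i _ _ ⟫ minF-lb m (λ i → leafMin (l i)) i

leafMin-right : ∀ {m n l r} j → leafMin (node m n l r) ≤ leafMin (r j)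
leafMin-right {n = n} {r = r} j = ℤP.i⊓j≤j _ _ ⟫ minF-lb n (λ j → leafMin (r j)) j

leafMax-left : ∀ {m n l r} i → leafMax (l i) ≤ leafMax (node m n l r)
leafMax-left {m} {l = l} i = maxF-ub m (λ i → leafMax (l i)) i ⟫ ℤP.i≤i⊔j _ _

leafMax-right : ∀ {m n l r} j → leafMax (r j) ≤ leafMax (node m n l r)
leafMax-right {n = n} {r = r} j = maxF-ub n (λ j → leafMax (r j)) j ⟫ ℤP.i≤j⊔i _ _

mutual
  leafMin≤Lo : ∀ K → leafMin K ≤ Lo K
  leafMin≤Lo (num a) = ℤP.≤-refl
  leafMin≤Lo (node m n l r) =
    leafMin-left {m} {n} {l} {r} zero ⟫ leafMin≤Ro (l zero) ⟫ maxF-ub m (λ i → Ro (l i)) zero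

  leafMin≤Ro : ∀ K → leafMin K ≤ Ro K
  leafMin≤Ro (num a) = ℤP.≤-refl
  leafMin≤Ro (node m n l r) = minF-glb n _ _ (λ j → leafMin-right {m} {n} {l} {r} j ⟫ leafMin≤Lo (r j))

mutual
  Lo≤leafMax : ∀ K → Lo K ≤ leafMax K
  Lo≤leafMax (num a) = ℤP.≤-refl
  Lo≤leafMax (node m n l r) = maxF-lub m _ _ (λ i → Ro≤leafMax (l i) ⟫ leafMax-left {m} {n} {l} {r} i)

  Ro≤leafMax : ∀ K → Ro K ≤ leafMax K
  Ro≤leafMax (num a) = ℤP.≤-refl
  Ro≤leafMax (node m n l r) =
    minF-lb n (λ j → Lo (r j)) zero ⟫ Lo≤leafMax (r zero) ⟫ leafMax-right {m} {n} {l} {r} zero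

pass : ℤ → Game
pass c = node 0 0 (λ _ → num c) (λ _ → num c)

pass-Lo : ∀ K c → c + leafMin K ≤ Lo (K ⊞ pass c)
pass-Lo K c =
  ℤP.+-monoʳ-≤ c (leafMin≤Ro K) ⟫ ≡⇒≤ (sym (Ro-shiftʳ c K)) ⟫ Lo-leftOptR K {pass c} (leftOpt zero)

pass-Ro : ∀ K c → Ro (K ⊞ pass c) ≤ c + leafMax K
pass-Ro K c =
  Ro-rightOptR K {pass c} (rightOpt zero) ⟫ ≡⇒≤ (Lo-shiftʳ c K) ⟫ ℤP.+-monoʳ-≤ c (Lo≤leafMax K)

probe : ℤ → Game
probe N = node 0 0 (λ _ → pass (- N)) (λ _ → pass N)

probe-wellTempered : ∀ N → WellTempered even (probe N)
probe-wellTempered N = wnode (λ _ → pass-wt) (λ _ → pass-wt)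
  where
  pass-wt : ∀ {c} → WellTempered odd (pass c)
  pass-wt = wnode (λ _ → wnum _) (λ _ → wnum _)

mutual
  probe-Ro-even : ∀ {K} N → WellTempered even K → N + leafMin K ≤ Ro (K ⊞ probe N)
  probe-Ro-even N (wnum a) =
    ≤-Ro (num a) (probe N) _ (inj₂ isNode) (λ ()) (λ { (rightOpt zero) → pass-Lo (num a) N })
  probe-Ro-even {K@(node m n l r)} N (wnode _ fr) =
    ≤-Ro K (probe N) _ (inj₂ isNode)
      (λ { (rightOpt j) → ℤP.+-monoʳ-≤ N (leafMin-right {m} {n} {l} {r} j) ⟫ probe-Lo-odd N (fr j) })
      (λ { (rightOpt zero) → pass-Lo K N })

  probe-Lo-odd : ∀ {K} N → WellTempered odd K → N + leafMin K ≤ Lo (K ⊞ probe N)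
  probe-Lo-odd {K@(node m n l r)} N (wnode fl _) =
    ℤP.+-monoʳ-≤ N (leafMin-left {m} {n} {l} {r} zero) ⟫ probe-Ro-even N (fl zero) ⟫
    Lo-leftOptL {K} (probe N) (leftOpt zero)

mutual
  probe-Lo-even : ∀ {K} N → WellTempered even K → Lo (K ⊞ probe N) ≤ - N + leafMax K
  probe-Lo-even N (wnum a) =
    Lo-≤ (num a) (probe N) _ (inj₂ isNode) (λ ()) (λ { (leftOpt zero) → pass-Ro (num a) (- N) })
  probe-Lo-even {K@(node m n l r)} N (wnode fl _) =
    Lo-≤ K (probe N) _ (inj₂ isNode)
      (λ { (leftOpt i) → probe-Ro-odd N (fl i) ⟫ ℤP.+-monoʳ-≤ (- N) (leafMax-left {m} {n} {l} {r} i) })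
      (λ { (leftOpt zero) → pass-Ro K (- N) })

  probe-Ro-odd : ∀ {K} N → WellTempered odd K → Ro (K ⊞ probe N) ≤ - N + leafMax K
  probe-Ro-odd {K@(node m n l r)} N (wnode _ fr) =
    Ro-rightOptL {K} (probe N) (rightOpt zero) ⟫ probe-Lo-even N (fr zero) ⟫
    ℤP.+-monoʳ-≤ (- N) (leafMax-right {m} {n} {l} {r} zero)

i≤∣i∣ : ∀ i → i ≤ + ∣ i ∣
i≤∣i∣ (+ n) = ℤP.≤-refl
i≤∣i∣ -[1+ n ] = ℤ.-≤+

probe-separates : ∀ a b → (+ suc ∣ b - a ∣) + a ≤ - (+ suc ∣ b - a ∣) + b → ⊥
probe-separates a b h = ℤP.≤⇒≯ (2N≤b-a ⟫ i≤∣i∣ (b - a)) ∣b-a∣<2N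
  where
  k : ℕ.ℕ
  k = ∣ b - a ∣
  N : ℤ
  N = + suc k
  lhs : ∀ N a → (N + a) + (N - a) ≡ N + N
  lhs = solve-∀
  rhs : ∀ N a b → (- N + b) + (N - a) ≡ b - a
  rhs = solve-∀
  2N≤b-a : N + N ≤ b - a
  2N≤b-a = subst₂ _≤_ (lhs N a) (rhs N a b) (ℤP.+-monoˡ-≤ (N - a) h)
  ∣b-a∣<2N : + k < N + N
  ∣b-a∣<2N = ℤ.+<+ (s≤s (ℕP.m≤m+n k (suc k)))

even≴odd : ∀ {G H} → WellTempered even G → WellTempered odd H → G ≲ H → ⊥
even≴odd {G} {H} dG dH G≲H = probe-separates (leafMin G) (leafMax H)
  (probe-Ro-even N dG ⟫ proj₂ (G≲H even (probe N) (probe-wellTempered N)) ⟫ probe-Ro-odd N dH)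
  where
  N : ℤ
  N = + suc ∣ leafMax H - leafMin G ∣

odd≴even : ∀ {G H} → WellTempered odd G → WellTempered even H → G ≲ H → ⊥
odd≴even {G} {H} dG dH G≲H = probe-separates (leafMin G) (leafMax H)
  (probe-Lo-odd N dG ⟫ proj₁ (G≲H even (probe N) (probe-wellTempered N)) ⟫ probe-Lo-even N dH)
  where
  N : ℤ
  N = + suc ∣ leafMax H - leafMin G ∣

0ᶜ-+ᶜ : ∀ x → 0ᶜ +ᶜ x ≡ᶜ x
0ᶜ-+ᶜ (mk a b xl xr) = ≡ᶜ-byOptions (λ i → 0ᶜ-+ᶜ (xl i)) (λ j → 0ᶜ-+ᶜ (xr j))

pickˡ : ∀ {a c} {A : Set} (f : Fin a → A) (g : Fin c → A) (P : A → Set) k → P (f k) →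
        Σ (Fin (a ℕ.+ c)) λ i → P ([ f , g ] (splitAt a i))
pickˡ f g P k p = (k ↑ˡ _) , subst P (sym ([,]-↑ˡ f g k)) p

pickʳ : ∀ {a c} {A : Set} (f : Fin a → A) (g : Fin c → A) (P : A → Set) k → P (g k) →
        Σ (Fin (a ℕ.+ c)) λ i → P ([ f , g ] (splitAt a i))
pickʳ {a} f g P k p = (a ↑ʳ k) , subst P (sym ([,]-↑ʳ f g k)) p

+ᶜ-comm-≤ : ∀ x y → x +ᶜ y ≤ᶜ y +ᶜ x
+ᶜ-comm-≤ x@(mk a b xl xr) y@(mk c d yl yr) =
  ≤-byOptions
    ([,]-all (λ z → Σ (Fin (c ℕ.+ a)) λ i' → z ≤ᶜ [ yxL₁ , yxL₂ ] (splitAt c i'))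
       (λ k → xl k +ᶜ y) (λ k → x +ᶜ yl k)
       (λ k → pickʳ yxL₁ yxL₂ (xl k +ᶜ y ≤ᶜ_) k (+ᶜ-comm-≤ (xl k) y))
       (λ k → pickˡ yxL₁ yxL₂ (x +ᶜ yl k ≤ᶜ_) k (+ᶜ-comm-≤ x (yl k))))
    ([,]-all (λ z → Σ (Fin (b ℕ.+ d)) λ j' → [ xyR₁ , xyR₂ ] (splitAt b j') ≤ᶜ z)
       (λ k → yr k +ᶜ x) (λ k → y +ᶜ xr k)
       (λ k → pickʳ xyR₁ xyR₂ (_≤ᶜ yr k +ᶜ x) k (+ᶜ-comm-≤ x (yr k)))
       (λ k → pickˡ xyR₁ xyR₂ (_≤ᶜ y +ᶜ xr k) k (+ᶜ-comm-≤ (xr k) y)))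
  where
  yxL₁ : Fin c → PG
  yxL₁ k = yl k +ᶜ x
  yxL₂ : Fin a → PG
  yxL₂ k = y +ᶜ xl k
  xyR₁ : Fin b → PG
  xyR₁ k = xr k +ᶜ y
  xyR₂ : Fin d → PG
  xyR₂ k = x +ᶜ yr k

+ᶜ-comm : ∀ x y → x +ᶜ y ≡ᶜ y +ᶜ x
+ᶜ-comm x y = +ᶜ-comm-≤ x y , +ᶜ-comm-≤ y x

+ᶜ-0ᶜ : ∀ x → x +ᶜ 0ᶜ ≡ᶜ x
+ᶜ-0ᶜ x = ≡ᶜ-trans (+ᶜ-comm x 0ᶜ) (0ᶜ-+ᶜ x)

negNatPG≡intPG : ∀ n → negNatPG n ≡ᶜ intPG (- (+ n))
negNatPG≡intPG zero = ≡ᶜ-refl _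
negNatPG≡intPG (suc n) = ≡ᶜ-refl _

-- Sums of two integers: in each case the sum has the options of the integer
-- a + b (by induction), so int-byOptions identifies it.
natPG-+ᶜ-natPG : ∀ m n → natPG m +ᶜ natPG n ≡ᶜ intPG (+ m + + n)
natPG-+ᶜ-natPG zero n = 0ᶜ-+ᶜ (natPG n)
natPG-+ᶜ-natPG (suc m) zero = ≡ᶜ-trans (+ᶜ-0ᶜ (natPG (suc m))) (intPG-cong (sym (ℤP.+-identityʳ (+ suc m))))
natPG-+ᶜ-natPG (suc m) (suc n) = int-byOptions (+ suc m + + suc n)
  (λ { zero → ≡ᶜ-trans (natPG-+ᶜ-natPG m (suc n)) (intPG-cong (e₁ (+ m) (+ n)))
     ; (suc zero) → ≡ᶜ-trans (natPG-+ᶜ-natPG (suc m) n) (intPG-cong (e₂ (+ m) (+ n))) })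
  (λ ()) (λ _ → zero) (λ { (ℤ.+<+ ()) })
  where
  e₁ : ∀ x y → x + (1ℤ + y) ≡ -1ℤ + ((1ℤ + x) + (1ℤ + y))
  e₁ = solve-∀
  e₂ : ∀ x y → (1ℤ + x) + y ≡ -1ℤ + ((1ℤ + x) + (1ℤ + y))
  e₂ = solve-∀

negNatPG-+ᶜ-negNatPG : ∀ m n → negNatPG m +ᶜ negNatPG n ≡ᶜ intPG (- (+ m) + - (+ n))
negNatPG-+ᶜ-negNatPG zero n =
  ≡ᶜ-trans (0ᶜ-+ᶜ (negNatPG n)) (≡ᶜ-trans (negNatPG≡intPG n) (intPG-cong (sym (ℤP.+-identityˡ (- (+ n))))))
negNatPG-+ᶜ-negNatPG (suc m) zero =
  ≡ᶜ-trans (+ᶜ-0ᶜ (negNatPG (suc m))) (intPG-cong (sym (ℤP.+-identityʳ (- (+ suc m)))))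
negNatPG-+ᶜ-negNatPG (suc m) (suc n) = int-byOptions (- (+ suc m) + - (+ suc n)) (λ ())
  (λ { zero → ≡ᶜ-trans (negNatPG-+ᶜ-negNatPG m (suc n)) (intPG-cong (e₁ (+ m) (+ n)))
     ; (suc zero) → ≡ᶜ-trans (negNatPG-+ᶜ-negNatPG (suc m) n) (intPG-cong (e₂ (+ m) (+ n))) })
  (λ ()) (λ _ → zero)
  where
  e₁ : ∀ x y → - x + - (1ℤ + y) ≡ 1ℤ + (- (1ℤ + x) + - (1ℤ + y))
  e₁ = solve-∀
  e₂ : ∀ x y → - (1ℤ + x) + - y ≡ 1ℤ + (- (1ℤ + x) + - (1ℤ + y))
  e₂ = solve-∀

natPG-+ᶜ-negNatPG : ∀ m n → natPG m +ᶜ negNatPG n ≡ᶜ intPG (+ m + - (+ n))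
natPG-+ᶜ-negNatPG zero n =
  ≡ᶜ-trans (0ᶜ-+ᶜ (negNatPG n)) (≡ᶜ-trans (negNatPG≡intPG n) (intPG-cong (sym (ℤP.+-identityˡ (- (+ n))))))
natPG-+ᶜ-negNatPG (suc m) zero =
  ≡ᶜ-trans (+ᶜ-0ᶜ (natPG (suc m))) (intPG-cong (sym (ℤP.+-identityʳ (+ suc m))))
natPG-+ᶜ-negNatPG (suc m) (suc n) = int-byOptions (+ suc m + - (+ suc n))
  (λ { zero → ≡ᶜ-trans (natPG-+ᶜ-negNatPG m (suc n)) (intPG-cong (e₁ (+ m) (+ n))) ; (suc ()) })
  (λ { zero → ≡ᶜ-trans (natPG-+ᶜ-negNatPG (suc m) n) (intPG-cong (e₂ (+ m) (+ n))) ; (suc ()) })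
  (λ _ → zero) (λ _ → zero)
  where
  e₁ : ∀ x y → x + - (1ℤ + y) ≡ -1ℤ + ((1ℤ + x) + - (1ℤ + y))
  e₁ = solve-∀
  e₂ : ∀ x y → (1ℤ + x) + - y ≡ 1ℤ + ((1ℤ + x) + - (1ℤ + y))
  e₂ = solve-∀

negNatPG-+ᶜ-natPG : ∀ m n → negNatPG m +ᶜ natPG n ≡ᶜ intPG (- (+ m) + + n)
negNatPG-+ᶜ-natPG m n =
  ≡ᶜ-trans (+ᶜ-comm (negNatPG m) (natPG n))
    (≡ᶜ-trans (natPG-+ᶜ-negNatPG n m) (intPG-cong (ℤP.+-comm (+ n) (- (+ m)))))

intPG-+ᶜ : ∀ a b → intPG a +ᶜ intPG b ≡ᶜ intPG (a + b)
intPG-+ᶜ (+ m) (+ n) = natPG-+ᶜ-natPG m n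
intPG-+ᶜ (+ m) -[1+ n ] = natPG-+ᶜ-negNatPG m (suc n)
intPG-+ᶜ -[1+ m ] (+ n) = negNatPG-+ᶜ-natPG (suc m) n
intPG-+ᶜ -[1+ m ] -[1+ n ] = negNatPG-+ᶜ-negNatPG (suc m) (suc n)

-- When one summand is an integer a, the
-- Conway sum a +ᶜ ψ H has the extra option (a - 1) + ψ H (or (a + 1) + ψ H),
-- which is dominated because adding integers to H moves ψ strictly.

num⊞-I₋₂ : ∀ {p H} a → I₋₂ p H → I₋₂ p (num a ⊞ H)
num⊞-I₋₂ a (inum b) = inum (a + b)
num⊞-I₋₂ a (ieven {m} {n} {l} {r} fl fr c) =
  ieven (λ i → num⊞-I₋₂ a (fl i)) (λ j → num⊞-I₋₂ a (fr j))
    (≡⇒≤ (Ro-shiftˡ a (node m n l r)) ⟫ ℤP.+-monoʳ-≤ a c ⟫ ≡⇒≤ (sym (Lo-shiftˡ a (node m n l r))))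
num⊞-I₋₂ a (iodd {m} {n} {l} {r} fl fr c) =
  iodd (λ i → num⊞-I₋₂ a (fl i)) (λ j → num⊞-I₋₂ a (fr j))
    (subst (- (+ 2) ≤_) (sym (trans (cong₂ _-_ (Lo-shiftˡ a H) (Ro-shiftˡ a H)) (cancel a _ _))) c)
  where
  H : Game
  H = node m n l r
  cancel : ∀ a L R → (a + L) - (a + R) ≡ L - R
  cancel = solve-∀

-- Adding a larger integer gives a strictly larger value: otherwise, by the
-- first half of the theorem, L(b + H) ≤ L(a + H), i.e. b ≤ a.
ψ-num⊞-strict : ∀ {p H} a b → I₋₂ p H → a < b → ψ (num a ⊞ H) ⧏ᶜ ψ (num b ⊞ H)
ψ-num⊞-strict {H = H} a b dH a<b =
  [ (λ le → ⊥-elim (ℤP.≤⇒≯ (Lo-shifted le) (ℤP.+-monoˡ-< (Lo H) a<b))) , (λ lt → lt) ]′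
    (≤-or-⧏ (ψ (num b ⊞ H)) (ψ (num a ⊞ H)))
  where
  Lo-shifted : ψ (num b ⊞ H) ≤ᶜ ψ (num a ⊞ H) → b + Lo H ≤ a + Lo H
  Lo-shifted le =
    ≡⇒≤ (sym (trans (Lo-+0 (num b ⊞ H)) (Lo-shiftˡ b H))) ⟫
    ψ≤⇒Lo≤ (num⊞-I₋₂ b dH) (num⊞-I₋₂ a dH) le (num 0ℤ) ⟫
    ≡⇒≤ (trans (Lo-+0 (num a ⊞ H)) (Lo-shiftˡ a H))

-- One more positive unit: the extra left option k + ψ H of (k+1) +ᶜ ψ H is
-- below ψ ((k+1) ⊞ H); all other options match by hypothesis.
num⊞-step-pos : ∀ k {p m n l r} → I₋₂ p (node m n l r) →
  (∀ i → ψ (num (+ suc k) ⊞ l i) ≡ᶜ natPG (suc k) +ᶜ ψ (l i)) →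
  (∀ j → ψ (num (+ suc k) ⊞ r j) ≡ᶜ natPG (suc k) +ᶜ ψ (r j)) →
  ψ (num (+ k) ⊞ node m n l r) ≡ᶜ natPG k +ᶜ ψ (node m n l r) →
  ψ (num (+ suc k) ⊞ node m n l r) ≡ᶜ natPG (suc k) +ᶜ ψ (node m n l r)
num⊞-step-pos k {m = m} {n} {l} {r} dH onL onR prev =
  ((λ i → ⧏-viaL (ψ (num (+ suc k) ⊞ l i)) (suc i) (proj₁ (onL i))) ,
   (λ j → ⧏-viaR (natPG (suc k) +ᶜ ψ (r j)) j (proj₁ (onR j)))) ,
  ((λ { zero → ≤-⧏-trans (natPG k +ᶜ ψ H) (ψ (num (+ k) ⊞ H)) (ψ (num (+ suc k) ⊞ H)) (proj₂ prev)
                 (ψ-num⊞-strict (+ k) (+ suc k) dH (ℤ.+<+ (ℕP.n<1+n k)))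
      ; (suc i) → ⧏-viaL (natPG (suc k) +ᶜ ψ (l i)) i (proj₂ (onL i)) }) ,
   (λ j → ⧏-viaR (ψ (num (+ suc k) ⊞ r j)) j (proj₂ (onR j))))
  where
  H : Game
  H = node m n l r

-- One more negative unit, dually with the extra right option.
num⊞-step-neg : ∀ k {p m n l r} → I₋₂ p (node m n l r) →
  (∀ i → ψ (num -[1+ k ] ⊞ l i) ≡ᶜ negNatPG (suc k) +ᶜ ψ (l i)) →
  (∀ j → ψ (num -[1+ k ] ⊞ r j) ≡ᶜ negNatPG (suc k) +ᶜ ψ (r j)) →
  ψ (num (ℤ.suc -[1+ k ]) ⊞ node m n l r) ≡ᶜ negNatPG k +ᶜ ψ (node m n l r) →
  ψ (num -[1+ k ] ⊞ node m n l r) ≡ᶜ negNatPG (suc k) +ᶜ ψ (node m n l r)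
num⊞-step-neg k {m = m} {n} {l} {r} dH onL onR prev =
  ((λ i → ⧏-viaL (ψ (num -[1+ k ] ⊞ l i)) i (proj₁ (onL i))) ,
   (λ { zero → ⧏-≤-trans (ψ (num -[1+ k ] ⊞ H)) (ψ (num (ℤ.suc -[1+ k ]) ⊞ H)) (negNatPG k +ᶜ ψ H)
                 (ψ-num⊞-strict -[1+ k ] (ℤ.suc -[1+ k ]) dH (<suc _)) (proj₁ prev)
      ; (suc j) → ⧏-viaR (negNatPG (suc k) +ᶜ ψ (r j)) j (proj₁ (onR j)) })) ,
  ((λ i → ⧏-viaL (negNatPG (suc k) +ᶜ ψ (l i)) i (proj₂ (onL i))) ,
   (λ j → ⧏-viaR (ψ (num -[1+ k ] ⊞ r j)) (suc j) (proj₂ (onR j))))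
  where
  H : Game
  H = node m n l r

ψ-num⊞-pos : ∀ k {p H} → I₋₂ p H → ψ (num (+ k) ⊞ H) ≡ᶜ natPG k +ᶜ ψ H
ψ-num⊞-pos k (inum b) = ≡ᶜ-sym (intPG-+ᶜ (+ k) b)
ψ-num⊞-pos zero {H = node _ _ _ _} dH =
  ≡ᶜ-byOptions (λ i → ψ-num⊞-pos zero (I-leftOpts dH i)) (λ j → ψ-num⊞-pos zero (I-rightOpts dH j))
ψ-num⊞-pos (suc k) {H = node _ _ _ _} dH =
  num⊞-step-pos k dH (λ i → ψ-num⊞-pos (suc k) (I-leftOpts dH i))
    (λ j → ψ-num⊞-pos (suc k) (I-rightOpts dH j)) (ψ-num⊞-pos k dH)

ψ-num⊞-neg : ∀ k {p H} → I₋₂ p H → ψ (num -[1+ k ] ⊞ H) ≡ᶜ negNatPG (suc k) +ᶜ ψ H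
ψ-num⊞-neg k (inum b) = ≡ᶜ-sym (intPG-+ᶜ -[1+ k ] b)
ψ-num⊞-neg zero {H = node _ _ _ _} dH =
  num⊞-step-neg zero dH (λ i → ψ-num⊞-neg zero (I-leftOpts dH i))
    (λ j → ψ-num⊞-neg zero (I-rightOpts dH j)) (ψ-num⊞-pos zero dH)
ψ-num⊞-neg (suc k) {H = node _ _ _ _} dH =
  num⊞-step-neg (suc k) dH (λ i → ψ-num⊞-neg (suc k) (I-leftOpts dH i))
    (λ j → ψ-num⊞-neg (suc k) (I-rightOpts dH j)) (ψ-num⊞-neg k dH)

ψ-num⊞ : ∀ a {p H} → I₋₂ p H → ψ (num a ⊞ H) ≡ᶜ intPG a +ᶜ ψ H
ψ-num⊞ (+ k) = ψ-num⊞-pos k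
ψ-num⊞ -[1+ k ] = ψ-num⊞-neg k

ψ-⊞num-swap : ∀ a H → ψ (H ⊞ num a) ≡ᶜ ψ (num a ⊞ H)
ψ-⊞num-swap a (num b) = intPG-cong (ℤP.+-comm b a)
ψ-⊞num-swap a (node m n l r) = ≡ᶜ-byOptions (λ i → ψ-⊞num-swap a (l i)) (λ j → ψ-⊞num-swap a (r j))

ψ-⊞ : ∀ {p q G H} → I₋₂ p G → I₋₂ q H → ψ (G ⊞ H) ≡ᶜ ψ G +ᶜ ψ H
ψ-⊞ (inum a) dH = ψ-num⊞ a dH
ψ-⊞ {G = G@(node _ _ _ _)} dG (inum a) =
  ≡ᶜ-trans (ψ-⊞num-swap a G) (≡ᶜ-trans (ψ-num⊞ a dG) (+ᶜ-comm (intPG a) (ψ G)))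
ψ-⊞ {G = G@(node m n l r)} {H@(node m' n' l' r')} dG dH =
  ≡ᶜ-byOptions
    (λ i → [_,_] {C = λ s → ψ ([ (λ k → l k ⊞ H) , (λ k → G ⊞ l' k) ] s) ≡ᶜ
                              [ (λ k → ψ (l k) +ᶜ ψ H) , (λ k → ψ G +ᶜ ψ (l' k)) ] s}
             (λ k → ψ-⊞ (I-leftOpts dG k) dH) (λ k → ψ-⊞ dG (I-leftOpts dH k)) (splitAt (suc m) i))
    (λ j → [_,_] {C = λ s → ψ ([ (λ k → r k ⊞ H) , (λ k → G ⊞ r' k) ] s) ≡ᶜ
                              [ (λ k → ψ (r k) +ᶜ ψ H) , (λ k → ψ G +ᶜ ψ (r' k)) ] s}
             (λ k → ψ-⊞ (I-rightOpts dG k) dH) (λ k → ψ-⊞ dG (I-rightOpts dH k)) (splitAt (suc n) j))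

-- Consequences: ψ is monotone on all of I₋₂ (incomparable parities are
-- vacuous), hence well defined on ≈-classes, and its kernel consists of the
-- classes of 0 and of ⟨-1 | 1⟩ = τ 0.

ψ-mono : (p q : Parity) (G H : Game) → I₋₂ p G → I₋₂ q H → G ≲ H → ψ G ≤ᶜ ψ H
ψ-mono even even G H dG dH = proj₂ (ψ≤⇔≲ even G H dG dH)
ψ-mono odd odd G H dG dH = proj₂ (ψ≤⇔≲ odd G H dG dH)
ψ-mono even odd G H dG dH G≲H = ⊥-elim (even≴odd (I⇒wellTempered dG) (I⇒wellTempered dH) G≲H)
ψ-mono odd even G H dG dH G≲H = ⊥-elim (odd≴even (I⇒wellTempered dG) (I⇒wellTempered dH) G≲H)

ψ-cong : (p q : Parity) (G H : Game) → I₋₂ p G → I₋₂ q H → G ≈ H → ψ G ≡ᶜ ψ H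
ψ-cong p q G H dG dH (G≲H , H≲G) = ψ-mono p q G H dG dH G≲H , ψ-mono q p H G dH dG H≲G

⟨-1∣1⟩-I₋₂ : I₋₂ odd ⟨-1∣1⟩
⟨-1∣1⟩-I₋₂ = τ-I₋₂ (inum (+ 0))

ψ⟨-1∣1⟩≡0 : ψ ⟨-1∣1⟩ ≡ᶜ 0ᶜ
ψ⟨-1∣1⟩≡0 = ψ-τ (num (+ 0))

ψ-kernel : (p : Parity) (G : Game) → I₋₂ p G →
           (ψ G ≡ᶜ 0ᶜ → (G ≈ num (+ 0) ⊎ G ≈ ⟨-1∣1⟩))
           × ((G ≈ num (+ 0) ⊎ G ≈ ⟨-1∣1⟩) → ψ G ≡ᶜ 0ᶜ)
ψ-kernel p G dG =
  kernel⇒ p dG , [ via (num (+ 0)) (inum (+ 0)) (≡ᶜ-refl 0ᶜ) , via ⟨-1∣1⟩ ⟨-1∣1⟩-I₋₂ ψ⟨-1∣1⟩≡0 ]′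
  where
  via : ∀ {q} Z → I₋₂ q Z → ψ Z ≡ᶜ 0ᶜ → G ≈ Z → ψ G ≡ᶜ 0ᶜ
  via {q} Z dZ ψZ≡0 G≈Z = ≡ᶜ-trans (ψ-cong p q G Z dG dZ G≈Z) ψZ≡0

  kernel⇒ : ∀ p → I₋₂ p G → ψ G ≡ᶜ 0ᶜ → G ≈ num (+ 0) ⊎ G ≈ ⟨-1∣1⟩
  kernel⇒ even dG (G≤0 , 0≤G) =
    inj₁ (proj₁ (ψ≤⇔≲ even G (num (+ 0)) dG (inum (+ 0))) G≤0 ,
          proj₁ (ψ≤⇔≲ even (num (+ 0)) G (inum (+ 0)) dG) 0≤G)
  kernel⇒ odd dG (G≤0 , 0≤G) =
    inj₂ (proj₁ (ψ≤⇔≲ odd G ⟨-1∣1⟩ dG ⟨-1∣1⟩-I₋₂)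
            (≤ᶜ-trans (ψ G) 0ᶜ (ψ ⟨-1∣1⟩) G≤0 (proj₂ ψ⟨-1∣1⟩≡0)) ,
          proj₁ (ψ≤⇔≲ odd ⟨-1∣1⟩ G ⟨-1∣1⟩-I₋₂ dG)
            (≤ᶜ-trans (ψ ⟨-1∣1⟩) 0ᶜ (ψ G) (proj₁ ψ⟨-1∣1⟩≡0) 0≤G))

mainTheorem15 :
    ((p : Parity) (G H : Game) → I₋₂ p G → I₋₂ p H →
        (ψ G ≤ᶜ ψ H → G ≲ H) × (G ≲ H → ψ G ≤ᶜ ψ H))
    × ((p q : Parity) (G H : Game) → I₋₂ p G → I₋₂ q H →
        G ≈ H → ψ G ≡ᶜ ψ H)
    × ((p q : Parity) (G H : Game) → I₋₂ p G → I₋₂ q H →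
        ψ (G ⊞ H) ≡ᶜ ψ G +ᶜ ψ H)
    × ((p q : Parity) (G H : Game) → I₋₂ p G → I₋₂ q H →
        G ≲ H → ψ G ≤ᶜ ψ H)
    × ((G H : Game) → I₋₂ even G → I₋₂ even H →
        (G ≲ H → ψ G ≤ᶜ ψ H) × (ψ G ≤ᶜ ψ H → G ≲ H))
    × ((p : Parity) (G : Game) → I₋₂ p G →
        (ψ G ≡ᶜ 0ᶜ → (G ≈ num (+ 0) ⊎ G ≈ ⟨-1∣1⟩))
        × ((G ≈ num (+ 0) ⊎ G ≈ ⟨-1∣1⟩) → ψ G ≡ᶜ 0ᶜ))
    × (I₋₂ even (num (+ 0)) × I₋₂ odd ⟨-1∣1⟩
        × ψ (num (+ 0)) ≡ᶜ 0ᶜ × ψ ⟨-1∣1⟩ ≡ᶜ 0ᶜ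
        × ¬ (num (+ 0) ≈ ⟨-1∣1⟩))
mainTheorem15 =
  ψ≤⇔≲ ,
  ψ-cong ,
  (λ _ _ _ _ → ψ-⊞) ,
  ψ-mono ,
  (λ G H dG dH → let (reflects , preserves) = ψ≤⇔≲ even G H dG dH in preserves , reflects) ,
  ψ-kernel ,
  (inum (+ 0) , ⟨-1∣1⟩-I₋₂ , ≡ᶜ-refl 0ᶜ , ψ⟨-1∣1⟩≡0 ,
   λ 0≈⟨-1∣1⟩ → even≴odd (wnum (+ 0)) (I⇒wellTempered ⟨-1∣1⟩-I₋₂) (proj₁ 0≈⟨-1∣1⟩))
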